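{- There is an absolute constant $C>0$ such that for infinitely many $n$ there exist a connected graph $G=(V,E)$ on $n$ nodes and a parameter $\lambda\in(0,1)$ for which the optimal value of the \textsc{LambdaCC} integer program on $(G,\lambda)$ is at least $C\log n$ times the optimal value of its LP relaxation. In other words, there exist choices of $\lambda$ for which the integrality gap of the \textsc{LambdaCC} LP relaxation is $\Omega(\log n)$.
   Context: \textsc{LambdaCC} (Lambda Correlation Clustering): given an undirected graph $G=(V,E)$ on $n$ nodes and $\lambda\in(0,1)$, a clustering is a partition of $V$. Its cost is $(1-\lambda)$ times the number of edges of $E$ whose endpoints lie in different clusters, plus $\lambda$ times the number of unordered pairs of distinct nodes $\{i,j\}\notin E$ whose nodes lie in the same cluster. Equivalently, the integer program has variables $x_{ij}\in\{0,1\}$ for unordered pairs $i\neq j$, with $x_{ij}=1$ meaning $i,j$ are separated. It minimizes $\sum_{(i,j)\in E}(1-\lambda)x_{ij}+\sum_{(i,j)\notin E}\lambda(1-x_{ij})$ subject to $x_{ij}\le x_{ik}+x_{jk}$ for all distinct $i,j,k$. The LP relaxation is the same program with $x_{ij}\in\{0,1\}$ replaced by $0\le x_{ij}\le 1$. The integrality gap is the ratio of the integer optimum to the LP optimum. -}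

module Defs where

open import Data.Nat as ℕ using (ℕ)
open import Data.Fin using (Fin; toℕ; zero; suc)
open import Data.Fin.Properties using (_≟_)
open import Data.Bool using (Bool; true; false; if_then_else_)
open import Data.Rational using (ℚ; 0ℚ; 1ℚ; _+_; _*_; _-_; _≤_; _<_)
open import Data.Product using (Σ; _×_; _,_)
open import Data.Empty using (⊥)
open import Relation.Nullary using (¬_; does)
open import Relation.Binary.PropositionalEquality using (_≡_)

record Graph (n : ℕ) : Set where
  field
    adj   : Fin n → Fin n → Bool
    sym   : ∀ i j → adj i j ≡ adj j i
    irref : ∀ i → adj i i ≡ false
open Graph public

data Walk {n : ℕ} (G : Graph n) : Fin n → Fin n → Set where
  here : ∀ {u} → Walk G u u
  step : ∀ {u w v} → adj G u w ≡ true → Walk G w v → Walk G u v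

Connected : ∀ {n} → Graph n → Set
Connected G = ∀ u v → Walk G u v

sumFin : ∀ {n} → (Fin n → ℚ) → ℚ
sumFin {ℕ.zero}  f = 0ℚ
sumFin {ℕ.suc n} f = f zero + sumFin {n} (λ i → f (suc i))

sumPairs : ∀ {n} → (Fin n → Fin n → ℚ) → ℚ
sumPairs f = sumFin (λ i → sumFin (λ j →
  if does (toℕ i ℕ.<? toℕ j) then f i j else 0ℚ))

cost : ∀ {n} → Graph n → ℚ → (Fin n → Fin n → ℚ) → ℚ
cost G lam x = sumPairs (λ i j →
  if adj G i j then (1ℚ - lam) * x i j else lam * (1ℚ - x i j))

LPFeasible : ∀ {n} → (Fin n → Fin n → ℚ) → Set
LPFeasible {n} x =
  (∀ i j → x i j ≡ x j i) ×
  (∀ i j → 0ℚ ≤ x i j) ×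
  (∀ i j → x i j ≤ 1ℚ) ×
  (∀ i j k → ¬ i ≡ j → ¬ i ≡ k → ¬ j ≡ k → x i j ≤ x i k + x j k)

-- A clustering (partition of V) is given by a cluster label for each node;
-- its 0/1 separation vector is the integral solution it induces.
Clustering : ℕ → Set
Clustering n = Fin n → Fin n

sepVec : ∀ {n} → Clustering n → Fin n → Fin n → ℚ
sepVec c i j = if does (c i ≟ c j) then 0ℚ else 1ℚ

ipCost : ∀ {n} → Graph n → ℚ → Clustering n → ℚ
ipCost G lam c = cost G lam (sepVec c)

-- The hard instances are hypercubes.  Take the cube {0,1}^d with d = 20t, so n = 2^d, and
-- λ = 1 / M with M = 64^t.  The fractional solution y a b = min 1 (hamming a b / t) costs O(n):
-- the d edges at a vertex a have length 1/t, and by a Chernoff-type estimate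
-- Σ_b (t ∸ hamming a b) ≤ t M, so the pairs at a that y keeps partly joined cost at most λ M = 1.
-- An integral clustering costs Ω(n t): by the edge-isoperimetric inequality a cluster of size
-- at most 2^(9t) keeps at most 18t of the 20t edges of an average member, so Ω(t) edges per
-- vertex are cut, while a larger cluster S pays λ for each of its ≈ |S|² non-adjacent pairs,
-- that is λ |S| ≥ t per vertex.  The ratio is Ω(t) = Ω(log n).
module Submission where

open import Data.Nat using (ℕ)

module NatEmbedding where

  open import Data.Nat as ℕ using (ℕ; suc; NonZero)
  import Data.Nat.Properties as ℕ
  open import Data.Integer as ℤ using (+_)
  import Data.Integer.Properties as ℤ
  open import Data.Rational using (ℚ; 0ℚ; 1ℚ; _+_; _*_; _≤_; _<_; _/_; toℚᵘ; positive; nonNegative)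
  open import Data.Rational.Properties
  import Data.Rational.Unnormalised as ℚᵘ
  import Data.Rational.Unnormalised.Properties as ℚᵘ
  open import Relation.Binary.PropositionalEquality

  opaque

    fromℕ : ℕ → ℚ
    fromℕ k = + k / 1

    fromℕ-def : ∀ k → fromℕ k ≡ + k / 1
    fromℕ-def k = refl

    toℚᵘ-fromℕ : ∀ k → toℚᵘ (fromℕ k) ℚᵘ.≃ ℚᵘ.mkℚᵘ (+ k) 0
    toℚᵘ-fromℕ k = toℚᵘ-fromℚᵘ (ℚᵘ.mkℚᵘ (+ k) 0)

    1/ℕ : (k : ℕ) → .{{NonZero k}} → ℚ
    1/ℕ k = + 1 / k

    fromℕ-*-1/ℕ : ∀ k .{{_ : NonZero k}} → fromℕ k * 1/ℕ k ≡ 1ℚ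
    fromℕ-*-1/ℕ (suc k) = toℚᵘ-injective (ℚᵘ.≃-trans (toℚᵘ-homo-* (fromℕ (suc k)) (1/ℕ (suc k)))
      (ℚᵘ.≃-trans (ℚᵘ.*-cong (toℚᵘ-fromℕ (suc k)) (toℚᵘ-fromℚᵘ (ℚᵘ.mkℚᵘ (+ 1) k)))
        (ℚᵘ.*≡* (begin
          (+ suc k ℤ.* + 1) ℤ.* + 1   ≡⟨ ℤ.*-identityʳ _ ⟩
          + suc k ℤ.* + 1             ≡⟨ ℤ.*-identityʳ _ ⟩
          + suc k                     ≡⟨ cong +_ (ℕ.*-identityˡ (suc k)) ⟨
          + (1 ℕ.* suc k)             ≡⟨ ℤ.*-identityˡ _ ⟨
          + 1 ℤ.* + (1 ℕ.* suc k)     ∎))))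
      where open ≡-Reasoning

    1/ℕ-pos : ∀ k .{{_ : NonZero k}} → 0ℚ < 1/ℕ k
    1/ℕ-pos (suc k) = toℚᵘ-cancel-< (ℚᵘ.<-respʳ-≃ (ℚᵘ.≃-sym (toℚᵘ-fromℚᵘ (ℚᵘ.mkℚᵘ (+ 1) k)))
      (ℚᵘ.*<* (ℤ.+<+ (ℕ.s≤s ℕ.z≤n))))

  private
    ⟦_⟧ᵘ : ℕ → ℚᵘ.ℚᵘ
    ⟦ k ⟧ᵘ = ℚᵘ.mkℚᵘ (+ k) 0

    ⟦⟧ᵘ-+ : ∀ a b → ⟦ a ℕ.+ b ⟧ᵘ ℚᵘ.≃ ⟦ a ⟧ᵘ ℚᵘ.+ ⟦ b ⟧ᵘ
    ⟦⟧ᵘ-+ a b = ℚᵘ.*≡* (begin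
      + (a ℕ.+ b) ℤ.* + 1                  ≡⟨ ℤ.*-identityʳ _ ⟩
      + (a ℕ.+ b)                          ≡⟨ ℤ.pos-+ a b ⟩
      + a ℤ.+ + b                          ≡⟨ cong₂ ℤ._+_ (ℤ.*-identityʳ (+ a)) (ℤ.*-identityʳ (+ b)) ⟨
      + a ℤ.* + 1 ℤ.+ + b ℤ.* + 1          ≡⟨ ℤ.*-identityʳ _ ⟨
      (+ a ℤ.* + 1 ℤ.+ + b ℤ.* + 1) ℤ.* + 1 ∎)
      where open ≡-Reasoning

    ⟦⟧ᵘ-* : ∀ a b → ⟦ a ℕ.* b ⟧ᵘ ℚᵘ.≃ ⟦ a ⟧ᵘ ℚᵘ.* ⟦ b ⟧ᵘ
    ⟦⟧ᵘ-* a b = ℚᵘ.*≡* (begin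
      + (a ℕ.* b) ℤ.* + 1       ≡⟨ ℤ.*-identityʳ _ ⟩
      + (a ℕ.* b)               ≡⟨ ℤ.pos-* a b ⟩
      + a ℤ.* + b               ≡⟨ ℤ.*-identityʳ _ ⟨
      (+ a ℤ.* + b) ℤ.* + 1     ∎)
      where open ≡-Reasoning

    ⟦⟧ᵘ-mono-≤ : ∀ {a b} → a ℕ.≤ b → ⟦ a ⟧ᵘ ℚᵘ.≤ ⟦ b ⟧ᵘ
    ⟦⟧ᵘ-mono-≤ {a} {b} a≤b =
      ℚᵘ.*≤* (subst₂ ℤ._≤_ (sym (ℤ.*-identityʳ (+ a))) (sym (ℤ.*-identityʳ (+ b))) (ℤ.+≤+ a≤b))

    ⟦⟧ᵘ-mono-< : ∀ {a b} → a ℕ.< b → ⟦ a ⟧ᵘ ℚᵘ.< ⟦ b ⟧ᵘ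
    ⟦⟧ᵘ-mono-< {a} {b} a<b =
      ℚᵘ.*<* (subst₂ ℤ._<_ (sym (ℤ.*-identityʳ (+ a))) (sym (ℤ.*-identityʳ (+ b))) (ℤ.+<+ a<b))

  fromℕ-+ : ∀ a b → fromℕ (a ℕ.+ b) ≡ fromℕ a + fromℕ b
  fromℕ-+ a b = toℚᵘ-injective (ℚᵘ.≃-trans (toℚᵘ-fromℕ (a ℕ.+ b)) (ℚᵘ.≃-trans (⟦⟧ᵘ-+ a b)
    (ℚᵘ.≃-sym (ℚᵘ.≃-trans (toℚᵘ-homo-+ (fromℕ a) (fromℕ b)) (ℚᵘ.+-cong (toℚᵘ-fromℕ a) (toℚᵘ-fromℕ b))))))

  fromℕ-* : ∀ a b → fromℕ (a ℕ.* b) ≡ fromℕ a * fromℕ b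
  fromℕ-* a b = toℚᵘ-injective (ℚᵘ.≃-trans (toℚᵘ-fromℕ (a ℕ.* b)) (ℚᵘ.≃-trans (⟦⟧ᵘ-* a b)
    (ℚᵘ.≃-sym (ℚᵘ.≃-trans (toℚᵘ-homo-* (fromℕ a) (fromℕ b)) (ℚᵘ.*-cong (toℚᵘ-fromℕ a) (toℚᵘ-fromℕ b))))))

  fromℕ-mono-≤ : ∀ {a b} → a ℕ.≤ b → fromℕ a ≤ fromℕ b
  fromℕ-mono-≤ {a} {b} a≤b = toℚᵘ-cancel-≤
    (ℚᵘ.≤-respˡ-≃ (ℚᵘ.≃-sym (toℚᵘ-fromℕ a)) (ℚᵘ.≤-respʳ-≃ (ℚᵘ.≃-sym (toℚᵘ-fromℕ b)) (⟦⟧ᵘ-mono-≤ a≤b)))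

  fromℕ-mono-< : ∀ {a b} → a ℕ.< b → fromℕ a < fromℕ b
  fromℕ-mono-< {a} {b} a<b = toℚᵘ-cancel-<
    (ℚᵘ.<-respˡ-≃ (ℚᵘ.≃-sym (toℚᵘ-fromℕ a)) (ℚᵘ.<-respʳ-≃ (ℚᵘ.≃-sym (toℚᵘ-fromℕ b)) (⟦⟧ᵘ-mono-< a<b)))

  fromℕ-0-* : ∀ s → fromℕ 0 * s ≡ 0ℚ
  fromℕ-0-* s = trans (cong (_* s) (fromℕ-def 0)) (*-zeroˡ s)

  fromℕ-+-* : ∀ a b s → fromℕ (a ℕ.+ b) * s ≡ fromℕ a * s + fromℕ b * s
  fromℕ-+-* a b s = trans (cong (_* s) (fromℕ-+ a b)) (*-distribʳ-+ s (fromℕ a) (fromℕ b))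

  fromℕ-*-mono-≤ : ∀ {a b} s → 0ℚ ≤ s → a ℕ.≤ b → fromℕ a * s ≤ fromℕ b * s
  fromℕ-*-mono-≤ s 0≤s a≤b = *-monoʳ-≤-nonNeg s {{nonNegative 0≤s}} (fromℕ-mono-≤ a≤b)

  fromℕ-*-mono-< : ∀ {a b} s → 0ℚ < s → a ℕ.< b → fromℕ a * s < fromℕ b * s
  fromℕ-*-mono-< s 0<s a<b = *-monoˡ-<-pos s {{positive 0<s}} (fromℕ-mono-< a<b)


module FinSums where

  open import Data.Nat using (ℕ; zero; suc; _+_; _≤_; _<?_)
  open import Data.Nat.Properties
  open import Data.Nat.Tactic.RingSolver using (solve-∀)
  open import Data.Fin using (Fin; toℕ)
  open import Data.Bool using (if_then_else_)
  open import Relation.Nullary using (does)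
  open import Relation.Binary.PropositionalEquality
  open import Algebra.Properties.Semiring.Sum +-*-semiring public
    using (sum; sum-syntax; sum-cong-≗; ∑-distrib-+; *-distribʳ-sum; sum-replicate-zero)

  sum-mono-≤ : ∀ {n} {f g : Fin n → ℕ} → (∀ i → f i ≤ g i) → sum f ≤ sum g
  sum-mono-≤ {zero}  f≤g = ≤-refl
  sum-mono-≤ {suc n} f≤g = +-mono-≤ (f≤g Fin.zero) (sum-mono-≤ (λ i → f≤g (Fin.suc i)))

  squareSum upperSum diagonalSum : ∀ {n} → (Fin n → Fin n → ℕ) → ℕ
  squareSum   {n} g = ∑[ i < n ] ∑[ j < n ] g i j
  upperSum    {n} g = ∑[ i < n ] ∑[ j < n ] (if does (toℕ i <? toℕ j) then g i j else 0)
  diagonalSum {n} g = ∑[ i < n ] g i i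

  squareSum-symmetric : ∀ {n} (g : Fin n → Fin n → ℕ) → (∀ i j → g i j ≡ g j i) →
                        squareSum g ≡ upperSum g + upperSum g + diagonalSum g
  squareSum-symmetric {zero}  g g-sym = refl
  squareSum-symmetric {suc n} g g-sym = begin
    squareSum g
      ≡⟨ cong (g₀₀ + row +_) (∑-distrib-+ (λ i → g (Fin.suc i) Fin.zero) (λ i → ∑[ j < n ] g⁺ i j)) ⟩
    g₀₀ + row + (column + squareSum g⁺)
      ≡⟨ cong (λ c → g₀₀ + row + (c + squareSum g⁺)) (sum-cong-≗ (λ i → g-sym (Fin.suc i) Fin.zero)) ⟩
    g₀₀ + row + (row + squareSum g⁺)
      ≡⟨ cong (λ s → g₀₀ + row + (row + s)) (squareSum-symmetric g⁺ (λ i j → g-sym (Fin.suc i) (Fin.suc j))) ⟩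
    g₀₀ + row + (row + (upperSum g⁺ + upperSum g⁺ + diagonalSum g⁺))
      ≡⟨ regroup g₀₀ row (upperSum g⁺) (diagonalSum g⁺) ⟩
    (row + upperSum g⁺) + (row + upperSum g⁺) + (g₀₀ + diagonalSum g⁺) ∎
    where
    open ≡-Reasoning
    g⁺ : Fin n → Fin n → ℕ
    g⁺ i j = g (Fin.suc i) (Fin.suc j)
    g₀₀ = g Fin.zero Fin.zero
    row = ∑[ j < n ] g Fin.zero (Fin.suc j)
    column = ∑[ i < n ] g (Fin.suc i) Fin.zero
    regroup : ∀ a r u e → a + r + (r + (u + u + e)) ≡ r + u + (r + u) + (a + e)
    regroup = solve-∀


module RationalSums where

  open import Data.Nat as ℕ using (ℕ; zero; suc)
  open import Data.Fin using (Fin; toℕ; _<_)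
  import Data.Fin.Properties as Fin
  open import Data.Bool using (true; false; if_then_else_)
  open import Data.Rational using (ℚ; 0ℚ; _+_; _*_; _≤_)
  open import Data.Rational.Properties
  open import Relation.Nullary using (does; ¬_; contradiction)
  open import Relation.Nullary.Decidable using (dec-true)
  open import Relation.Binary using (tri<; tri≈; tri>)
  open import Relation.Binary.PropositionalEquality
  open import Defs using (sumFin; sumPairs)
  open NatEmbedding
  open FinSums using (sum; upperSum)

  sumFin-cong : ∀ {n} {f g : Fin n → ℚ} → (∀ i → f i ≡ g i) → sumFin f ≡ sumFin g
  sumFin-cong {zero}  f≡g = refl
  sumFin-cong {suc n} f≡g = cong₂ _+_ (f≡g Fin.zero) (sumFin-cong (λ i → f≡g (Fin.suc i)))

  sumFin-fromℕ : ∀ {n} (h : Fin n → ℕ) s → sumFin (λ i → fromℕ (h i) * s) ≡ fromℕ (sum h) * s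
  sumFin-fromℕ {zero}  h s = sym (fromℕ-0-* s)
  sumFin-fromℕ {suc n} h s = trans (cong (fromℕ (h Fin.zero) * s +_) (sumFin-fromℕ (λ i → h (Fin.suc i)) s))
                                   (sym (fromℕ-+-* (h Fin.zero) (sum (λ i → h (Fin.suc i))) s))

  sumPairs-cong : ∀ {n} {f g : Fin n → Fin n → ℚ} → (∀ i j → f i j ≡ g i j) → sumPairs f ≡ sumPairs g
  sumPairs-cong f≡g = sumFin-cong (λ i → sumFin-cong (λ j →
    cong (λ x → if does (toℕ i ℕ.<? toℕ j) then x else 0ℚ) (f≡g i j)))

  sumPairs-fromℕ : ∀ {n} (g : Fin n → Fin n → ℕ) s →
                   sumPairs (λ i j → fromℕ (g i j) * s) ≡ fromℕ (upperSum g) * s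
  sumPairs-fromℕ {n} g s = trans
    (sumFin-cong (λ i → trans (sumFin-cong (λ j → if-fromℕ (does (toℕ i ℕ.<? toℕ j)) (g i j)))
                              (sumFin-fromℕ (masked i) s)))
    (sumFin-fromℕ (λ i → sum (masked i)) s)
    where
    masked : Fin n → Fin n → ℕ
    masked i j = if does (toℕ i ℕ.<? toℕ j) then g i j else 0
    if-fromℕ : ∀ b k → (if b then fromℕ k * s else 0ℚ) ≡ fromℕ (if b then k else 0) * s
    if-fromℕ true  k = refl
    if-fromℕ false k = sym (fromℕ-0-* s)

  sumFin-nonNeg : ∀ {n} (f : Fin n → ℚ) → (∀ i → 0ℚ ≤ f i) → 0ℚ ≤ sumFin f
  sumFin-nonNeg {zero}  f f≥0 = ≤-refl
  sumFin-nonNeg {suc n} f f≥0 =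
    +-mono-≤ (f≥0 Fin.zero) (sumFin-nonNeg (λ i → f (Fin.suc i)) (λ i → f≥0 (Fin.suc i)))

  term≤sumFin : ∀ {n} (f : Fin n → ℚ) → (∀ i → 0ℚ ≤ f i) → ∀ k → f k ≤ sumFin f
  term≤sumFin f f≥0 Fin.zero = subst (_≤ sumFin f) (+-identityʳ (f Fin.zero))
    (+-monoʳ-≤ (f Fin.zero) (sumFin-nonNeg (λ i → f (Fin.suc i)) (λ i → f≥0 (Fin.suc i))))
  term≤sumFin f f≥0 (Fin.suc k) = subst (_≤ sumFin f) (+-identityˡ (f (Fin.suc k)))
    (+-mono-≤ (f≥0 Fin.zero) (term≤sumFin (λ i → f (Fin.suc i)) (λ i → f≥0 (Fin.suc i)) k))

  module _ {n} (f : Fin n → Fin n → ℚ) (f≥0 : ∀ i j → 0ℚ ≤ f i j) where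

    private
      masked : Fin n → Fin n → ℚ
      masked i j = if does (toℕ i ℕ.<? toℕ j) then f i j else 0ℚ

      masked≥0 : ∀ i j → 0ℚ ≤ masked i j
      masked≥0 i j with does (toℕ i ℕ.<? toℕ j)
      ... | true  = f≥0 i j
      ... | false = ≤-refl

    upperTerm≤sumPairs : ∀ {u v} → u < v → f u v ≤ sumPairs f
    upperTerm≤sumPairs {u} {v} u<v = ≤-trans
      (subst (λ b → (if b then f u v else 0ℚ) ≤ sumFin (masked u)) (dec-true (toℕ u ℕ.<? toℕ v) u<v)
        (term≤sumFin (masked u) (masked≥0 u) v))
      (term≤sumFin (λ i → sumFin (masked i)) (λ i → sumFin-nonNeg (masked i) (masked≥0 i)) u)

    term≤sumPairs : (∀ i j → f i j ≡ f j i) → ∀ {u v} → ¬ u ≡ v → f u v ≤ sumPairs f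
    term≤sumPairs f-sym {u} {v} u≢v with Fin.<-cmp u v
    ... | tri< u<v _ _ = upperTerm≤sumPairs u<v
    ... | tri≈ _ u≡v _ = contradiction u≡v u≢v
    ... | tri> _ _ v<u = subst (_≤ sumPairs f) (f-sym v u) (upperTerm≤sumPairs v<u)


module Positivity where

  open import Data.Bool using (Bool; true; false; if_then_else_)
  open import Data.Rational using (ℚ; 0ℚ; 1ℚ; _*_; _-_; _≤_; _<_; _<?_; -_; positive; nonNegative)
  open import Data.Rational.Properties
  open import Relation.Nullary using (¬_; yes; no)
  open import Relation.Binary.PropositionalEquality
  open import Data.Product using (_,_)
  open import Defs using (Graph; adj; cost; LPFeasible)
  open RationalSums using (term≤sumPairs)

  *-nonNeg : ∀ {p q} → 0ℚ ≤ p → 0ℚ ≤ q → 0ℚ ≤ p * q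
  *-nonNeg {p} {q} 0≤p 0≤q =
    nonNegative⁻¹ (p * q) {{nonNeg*nonNeg⇒nonNeg p {{nonNegative 0≤p}} q {{nonNegative 0≤q}}}}

  *-pos : ∀ {p q} → 0ℚ < p → 0ℚ < q → 0ℚ < p * q
  *-pos {p} {q} 0<p 0<q = positive⁻¹ (p * q) {{pos*pos⇒pos p {{positive 0<p}} q {{positive 0<q}}}}

  1-p-nonNeg : ∀ {p} → p ≤ 1ℚ → 0ℚ ≤ 1ℚ - p
  1-p-nonNeg {p} p≤1 = subst (_≤ 1ℚ - p) (+-inverseʳ p) (+-monoˡ-≤ (- p) p≤1)

  1-p-pos : ∀ {p} → p < 1ℚ → 0ℚ < 1ℚ - p
  1-p-pos {p} p<1 = subst (_< 1ℚ - p) (+-inverseʳ p) (+-monoˡ-< (- p) p<1)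

  module _ {n} (G : Graph n) {lam : ℚ} (0<lam : 0ℚ < lam) (lam<1 : lam < 1ℚ) where

    private
      term : Bool → ℚ → ℚ
      term e x = if e then (1ℚ - lam) * x else lam * (1ℚ - x)

      term≤cost : ∀ z → LPFeasible z → ∀ {i j} → ¬ i ≡ j → term (adj G i j) (z i j) ≤ cost G lam z
      term≤cost z (z-sym , z≥0 , z≤1 , _) i≢j = term≤sumPairs (λ i j → term (adj G i j) (z i j)) term≥0
        (λ i j → cong₂ term (Graph.sym G i j) (z-sym i j)) i≢j
        where
        term≥0 : ∀ i j → 0ℚ ≤ term (adj G i j) (z i j)
        term≥0 i j with adj G i j
        ... | true  = *-nonNeg (1-p-nonNeg (<⇒≤ lam<1)) (z≥0 i j)
        ... | false = *-nonNeg (<⇒≤ 0<lam) (1-p-nonNeg (z≤1 i j))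

      edge-term-pos : ∀ {i j x} → adj G i j ≡ true → 0ℚ < x → 0ℚ < term (adj G i j) x
      edge-term-pos ij 0<x rewrite ij = *-pos (1-p-pos lam<1) 0<x

    -- Along an induced path u – w – v a feasible z either separates one of the two edges
    -- or, by the triangle inequality, keeps the non-adjacent pair u, v partly together.
    cost-pos-on-induced-path : ∀ {u w v} → ¬ u ≡ w → ¬ u ≡ v → ¬ v ≡ w →
      adj G u w ≡ true → adj G v w ≡ true → adj G u v ≡ false →
      ∀ z → LPFeasible z → 0ℚ < cost G lam z
    cost-pos-on-induced-path {u} {w} {v} u≢w u≢v v≢w uw vw uv z z-feasible@(_ , _ , _ , z-tri)
      with 0ℚ <? z u w | 0ℚ <? z v w
    ... | yes 0<zuw | _ = <-≤-trans (edge-term-pos uw 0<zuw) (term≤cost z z-feasible u≢w)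
    ... | no _ | yes 0<zvw = <-≤-trans (edge-term-pos vw 0<zvw) (term≤cost z z-feasible v≢w)
    ... | no zuw≯0 | no zvw≯0 = <-≤-trans non-edge-term-pos (term≤cost z z-feasible u≢v)
      where
      zuv<1 : z u v < 1ℚ
      zuv<1 = ≤-<-trans (z-tri u v w u≢v u≢w v≢w)
                (≤-<-trans (+-mono-≤ (≮⇒≥ zuw≯0) (≮⇒≥ zvw≯0)) (positive⁻¹ 1ℚ))
      non-edge-term-pos : 0ℚ < term (adj G u v) (z u v)
      non-edge-term-pos rewrite uv = *-pos 0<lam (1-p-pos zuv<1)


module ScaledCosts where

  open import Data.Nat as ℕ using (ℕ; _∸_; _≤_)
  import Data.Nat.Properties as ℕ
  open import Data.Bool using (Bool; true; false; if_then_else_)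
  open import Data.Fin using (Fin)
  open import Data.Fin.Properties using (_≟_)
  open import Data.Rational using (ℚ; 0ℚ; 1ℚ; _+_; _*_; _-_)
  open import Data.Rational.Properties using (*-zeroʳ; *-identityʳ; +-inverseʳ)
  open import Data.Rational.Solver using (module +-*-Solver)
  open import Relation.Nullary using (does)
  open import Relation.Binary.PropositionalEquality
  open import Defs using (Graph; adj; cost; ipCost; Clustering; sepVec)
  open NatEmbedding
  open FinSums using (upperSum)
  open RationalSums using (sumPairs-cong; sumPairs-fromℕ)
  open +-*-Solver

  disagreement : ℕ → ℕ → Bool → Bool → ℕ
  disagreement A B true  true  = 0
  disagreement A B false true  = A
  disagreement A B true  false = B
  disagreement A B false false = 0

  fractionalDisagreement : ℕ → ℕ → ℕ → Bool → ℕ → ℕ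
  fractionalDisagreement A B K edge q = if edge then A ℕ.* q else B ℕ.* (K ∸ q)

  -- With λ = t / K and distances q / K, every term of the objective is an integer over K².
  module _ {n} (G : Graph n) {t K : ℕ} (t≤K : t ≤ K) {r : ℚ} (Kr≡1 : fromℕ K * r ≡ 1ℚ) where

    0≡0*r : 0ℚ ≡ fromℕ 0 * r
    0≡0*r = sym (fromℕ-0-* r)

    1-fromℕ*r : ∀ {q} → q ≤ K → 1ℚ - fromℕ q * r ≡ fromℕ (K ∸ q) * r
    1-fromℕ*r {q} q≤K = begin
      1ℚ - fromℕ q * r                            ≡⟨ cong (_- fromℕ q * r) Kr≡1 ⟨
      fromℕ K * r - fromℕ q * r                   ≡⟨ cong (λ k → fromℕ k * r - fromℕ q * r) (ℕ.m∸n+n≡m q≤K) ⟨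
      fromℕ (K ∸ q ℕ.+ q) * r - fromℕ q * r       ≡⟨ cong (λ x → x * r - fromℕ q * r) (fromℕ-+ (K ∸ q) q) ⟩
      (fromℕ (K ∸ q) + fromℕ q) * r - fromℕ q * r ≡⟨ solve 3 (λ a b r → (a :+ b) :* r :- b :* r := a :* r)
                                                        refl (fromℕ (K ∸ q)) (fromℕ q) r ⟩
      fromℕ (K ∸ q) * r                           ∎
      where open ≡-Reasoning

    fromℕ*r-* : ∀ a b → (fromℕ a * r) * (fromℕ b * r) ≡ fromℕ (a ℕ.* b) * (r * r)
    fromℕ*r-* a b = trans (solve 3 (λ a b r → (a :* r) :* (b :* r) := (a :* b) :* (r :* r)) refl (fromℕ a) (fromℕ b) r)
                          (cong (_* (r * r)) (sym (fromℕ-* a b)))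

    cost-scaled : (q : Fin n → Fin n → ℕ) → (∀ i j → q i j ≤ K) →
                  cost G (fromℕ t * r) (λ i j → fromℕ (q i j) * r) ≡
                  fromℕ (upperSum (λ i j → fractionalDisagreement (K ∸ t) t K (adj G i j) (q i j))) * (r * r)
    cost-scaled q q≤K = trans (sumPairs-cong term)
      (sumPairs-fromℕ (λ i j → fractionalDisagreement (K ∸ t) t K (adj G i j) (q i j)) (r * r))
      where
      term : ∀ i j → (if adj G i j then (1ℚ - fromℕ t * r) * (fromℕ (q i j) * r)
                                   else fromℕ t * r * (1ℚ - fromℕ (q i j) * r)) ≡
                     fromℕ (fractionalDisagreement (K ∸ t) t K (adj G i j) (q i j)) * (r * r)
      term i j with adj G i j
      ... | true  = trans (cong (_* (fromℕ (q i j) * r)) (1-fromℕ*r t≤K)) (fromℕ*r-* (K ∸ t) (q i j))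
      ... | false = trans (cong (fromℕ t * r *_) (1-fromℕ*r (q≤K i j))) (fromℕ*r-* t (K ∸ q i j))

    ipCost-scaled : (c : Clustering n) →
                    ipCost G (fromℕ t * r) c ≡
                    fromℕ (upperSum (λ i j → disagreement (K ∸ t) t (does (c i ≟ c j)) (adj G i j))) * r
    ipCost-scaled c = trans (sumPairs-cong term)
      (sumPairs-fromℕ (λ i j → disagreement (K ∸ t) t (does (c i ≟ c j)) (adj G i j)) r)
      where
      term : ∀ i j → (if adj G i j then (1ℚ - fromℕ t * r) * sepVec c i j
                                   else fromℕ t * r * (1ℚ - sepVec c i j)) ≡
                     fromℕ (disagreement (K ∸ t) t (does (c i ≟ c j)) (adj G i j)) * r
      term i j with does (c i ≟ c j) | adj G i j
      ... | true  | true  = trans (*-zeroʳ (1ℚ - fromℕ t * r)) 0≡0*r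
      ... | false | true  = trans (*-identityʳ (1ℚ - fromℕ t * r)) (1-fromℕ*r t≤K)
      ... | true  | false = *-identityʳ (fromℕ t * r)
      ... | false | false = trans (cong (fromℕ t * r *_) (+-inverseʳ 1ℚ)) (trans (*-zeroʳ (fromℕ t * r)) 0≡0*r)


module NatFacts where

  open import Data.Nat using (zero; suc; _+_; _*_; _≤_; _<_; z≤n; s≤s; _^_; _⊓_)
  open import Data.Nat.Properties
  open import Data.Nat.Tactic.RingSolver using (solve-∀)
  open import Data.Sum using (inj₁; inj₂)
  open import Relation.Binary.PropositionalEquality

  ^-distribʳ-* : ∀ a b n → (a * b) ^ n ≡ a ^ n * b ^ n
  ^-distribʳ-* a b zero    = refl
  ^-distribʳ-* a b (suc n) rewrite ^-distribʳ-* a b n = interchange a b (a ^ n) (b ^ n)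
    where
    interchange : ∀ a b x y → a * b * (x * y) ≡ a * x * (b * y)
    interchange = solve-∀

  2n≤8^n : ∀ n → 2 * n ≤ 8 ^ n
  2n≤8^n zero    = z≤n
  2n≤8^n (suc n) = begin
    2 * suc n          ≡⟨ *-suc 2 n ⟩
    2 + 2 * n          ≤⟨ +-mono-≤ (≤-trans (s≤s (s≤s z≤n)) (*-monoʳ-≤ 7 (^-monoʳ-≤ 8 {0} {n} z≤n))) (2n≤8^n n) ⟩
    7 * 8 ^ n + 8 ^ n  ≡⟨ +-comm (7 * 8 ^ n) (8 ^ n) ⟩
    8 * 8 ^ n          ∎
    where open ≤-Reasoning

  ⊓-triangle : ∀ m {a b c} → a ≤ b + c → m ⊓ a ≤ m ⊓ b + m ⊓ c
  ⊓-triangle m {a} {b} {c} a≤b+c with ≤-total m b | ≤-total m c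
  ... | inj₁ m≤b | _ rewrite m≤n⇒m⊓n≡m m≤b = ≤-trans (m⊓n≤m m a) (m≤m+n m (m ⊓ c))
  ... | inj₂ b≤m | inj₁ m≤c rewrite m≤n⇒m⊓n≡m m≤c = ≤-trans (m⊓n≤m m a) (m≤n+m m (m ⊓ b))
  ... | inj₂ b≤m | inj₂ c≤m rewrite m≥n⇒m⊓n≡n b≤m | m≥n⇒m⊓n≡n c≤m = ≤-trans (m⊓n≤n m a) a≤b+c

  ≤both⇒≤0 : ∀ {a b x} → a + b ≤ 1 → x ≤ a → x ≤ b → x ≤ 0
  ≤both⇒≤0 {zero}      _             x≤a _   = x≤a
  ≤both⇒≤0 {suc a} {b} (s≤s a+b≤0) _   x≤b = ≤-trans x≤b (≤-trans (m≤n+m b a) a+b≤0)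

  other-half-small : ∀ {p x y} → p < x → x + y ≤ 2 * p → y ≤ p
  other-half-small {p} {x} {y} p<x x+y≤2p = ≤-trans (<⇒≤ (+-cancelˡ-< p y (p + 0)
    (≤-trans (+-monoˡ-< y p<x) x+y≤2p))) (≤-reflexive (+-identityʳ p))


module Hypercube where

  open import Data.Nat using (ℕ; zero; suc; _+_; _*_; _≤_; z≤n; _∸_; _^_; _≡ᵇ_)
  open import Data.Nat.Properties
  open import Data.Nat.Tactic.RingSolver using (solve-∀)
  open import Data.Bool using (Bool; true; false)
  open import Data.Vec using (Vec; []; _∷_)
  open import Data.Fin using (Fin)
  open import Relation.Nullary using (yes; no)
  open import Relation.Binary.PropositionalEquality
  open import Algebra.Properties.CommutativeSemigroup +-commutativeSemigroup using (interchange)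
  open FinSums using (sum)
  open NatFacts using (≤both⇒≤0; other-half-small)

  Cube : ℕ → Set
  Cube d = Vec Bool d

  cubeSize : ℕ → ℕ
  cubeSize zero    = 1
  cubeSize (suc d) = cubeSize d + cubeSize d

  cubeSum : ∀ {d} → (Cube d → ℕ) → ℕ
  cubeSum {zero}  f = f []
  cubeSum {suc d} f = cubeSum (λ v → f (false ∷ v)) + cubeSum (λ v → f (true ∷ v))

  cubeSum-cong : ∀ {d} {f g : Cube d → ℕ} → (∀ v → f v ≡ g v) → cubeSum f ≡ cubeSum g
  cubeSum-cong {zero}  f≡g = f≡g []
  cubeSum-cong {suc d} f≡g = cong₂ _+_ (cubeSum-cong (λ v → f≡g (false ∷ v))) (cubeSum-cong (λ v → f≡g (true ∷ v)))

  cubeSum-mono-≤ : ∀ {d} {f g : Cube d → ℕ} → (∀ v → f v ≤ g v) → cubeSum f ≤ cubeSum g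
  cubeSum-mono-≤ {zero}  f≤g = f≤g []
  cubeSum-mono-≤ {suc d} f≤g =
    +-mono-≤ (cubeSum-mono-≤ (λ v → f≤g (false ∷ v))) (cubeSum-mono-≤ (λ v → f≤g (true ∷ v)))

  cubeSum-distrib-+ : ∀ {d} (f g : Cube d → ℕ) → cubeSum (λ v → f v + g v) ≡ cubeSum f + cubeSum g
  cubeSum-distrib-+ {zero}  f g = refl
  cubeSum-distrib-+ {suc d} f g
    rewrite cubeSum-distrib-+ (λ v → f (false ∷ v)) (λ v → g (false ∷ v))
          | cubeSum-distrib-+ (λ v → f (true ∷ v)) (λ v → g (true ∷ v)) =
    interchange (cubeSum (λ v → f (false ∷ v))) (cubeSum (λ v → g (false ∷ v)))
                (cubeSum (λ v → f (true ∷ v))) (cubeSum (λ v → g (true ∷ v)))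

  cubeSum-*ˡ : ∀ {d} k (f : Cube d → ℕ) → cubeSum (λ v → k * f v) ≡ k * cubeSum f
  cubeSum-*ˡ {zero}  k f = refl
  cubeSum-*ˡ {suc d} k f rewrite cubeSum-*ˡ k (λ v → f (false ∷ v)) | cubeSum-*ˡ k (λ v → f (true ∷ v)) =
    sym (*-distribˡ-+ k (cubeSum (λ v → f (false ∷ v))) (cubeSum (λ v → f (true ∷ v))))

  cubeSum-const : ∀ {d} k → cubeSum {d} (λ _ → k) ≡ cubeSize d * k
  cubeSum-const {zero}  k = sym (+-identityʳ k)
  cubeSum-const {suc d} k rewrite cubeSum-const {d} k = sym (*-distribʳ-+ k (cubeSize d) (cubeSize d))

  cubeSum-zero : ∀ {d} → cubeSum {d} (λ _ → 0) ≡ 0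
  cubeSum-zero {d} = trans (cubeSum-const {d} 0) (*-zeroʳ (cubeSize d))

  cubeSum-comm : ∀ {d e} (f : Cube d → Cube e → ℕ) →
                 cubeSum (λ a → cubeSum (λ b → f a b)) ≡ cubeSum (λ b → cubeSum (λ a → f a b))
  cubeSum-comm {zero}  f = refl
  cubeSum-comm {suc d} f = begin
    cubeSum (λ a → cubeSum (f (false ∷ a))) + cubeSum (λ a → cubeSum (f (true ∷ a)))
      ≡⟨ cong₂ _+_ (cubeSum-comm (λ a → f (false ∷ a))) (cubeSum-comm (λ a → f (true ∷ a))) ⟩
    cubeSum (λ b → cubeSum (λ a → f (false ∷ a) b)) + cubeSum (λ b → cubeSum (λ a → f (true ∷ a) b))
      ≡⟨ cubeSum-distrib-+ (λ b → cubeSum (λ a → f (false ∷ a) b)) (λ b → cubeSum (λ a → f (true ∷ a) b)) ⟨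
    cubeSum (λ b → cubeSum (λ a → f (false ∷ a) b) + cubeSum (λ a → f (true ∷ a) b)) ∎
    where open ≡-Reasoning

  cubeSum-sum-comm : ∀ {d m} (f : Cube d → Fin m → ℕ) →
                     cubeSum (λ a → sum (f a)) ≡ sum (λ l → cubeSum (λ a → f a l))
  cubeSum-sum-comm {d} {zero}  f = cubeSum-zero {d}
  cubeSum-sum-comm {d} {suc m} f = trans (cubeSum-distrib-+ (λ a → f a Fin.zero) (λ a → sum (λ l → f a (Fin.suc l))))
    (cong (cubeSum (λ a → f a Fin.zero) +_) (cubeSum-sum-comm (λ a l → f a (Fin.suc l))))

  ⟦_⟧ : Bool → ℕ
  ⟦ true  ⟧ = 1
  ⟦ false ⟧ = 0

  ⟦⟧*≤ : ∀ b k → ⟦ b ⟧ * k ≤ k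
  ⟦⟧*≤ true  k = ≤-reflexive (+-identityʳ k)
  ⟦⟧*≤ false k = z≤n

  bitDistance : Bool → Bool → ℕ
  bitDistance false false = 0
  bitDistance false true  = 1
  bitDistance true  false = 1
  bitDistance true  true  = 0

  hamming : ∀ {d} → Cube d → Cube d → ℕ
  hamming []      []      = 0
  hamming (x ∷ a) (y ∷ b) = bitDistance x y + hamming a b

  adjacent : ∀ {d} → Cube d → Cube d → Bool
  adjacent a b = hamming a b ≡ᵇ 1

  bitDistance-sym : ∀ x y → bitDistance x y ≡ bitDistance y x
  bitDistance-sym false false = refl
  bitDistance-sym false true  = refl
  bitDistance-sym true  false = refl
  bitDistance-sym true  true  = refl

  hamming-sym : ∀ {d} (a b : Cube d) → hamming a b ≡ hamming b a
  hamming-sym []      []      = refl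
  hamming-sym (x ∷ a) (y ∷ b) = cong₂ _+_ (bitDistance-sym x y) (hamming-sym a b)

  bitDistance-self : ∀ x → bitDistance x x ≡ 0
  bitDistance-self false = refl
  bitDistance-self true  = refl

  hamming-self : ∀ {d} (a : Cube d) → hamming a a ≡ 0
  hamming-self []      = refl
  hamming-self (x ∷ a) rewrite bitDistance-self x = hamming-self a

  bitDistance-triangle : ∀ x y z → bitDistance x z ≤ bitDistance x y + bitDistance y z
  bitDistance-triangle false false false = z≤n
  bitDistance-triangle false false true  = ≤-refl
  bitDistance-triangle false true  false = z≤n
  bitDistance-triangle false true  true  = ≤-refl
  bitDistance-triangle true  false false = ≤-refl
  bitDistance-triangle true  false true  = z≤n
  bitDistance-triangle true  true  false = ≤-refl
  bitDistance-triangle true  true  true  = z≤n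

  hamming-triangle : ∀ {d} (a b c : Cube d) → hamming a c ≤ hamming a b + hamming b c
  hamming-triangle []      []      []      = z≤n
  hamming-triangle (x ∷ a) (y ∷ b) (z ∷ c) =
    ≤-trans (+-mono-≤ (bitDistance-triangle x y z) (hamming-triangle a b c))
            (≤-reflexive (interchange (bitDistance x y) (bitDistance y z) (hamming a b) (hamming b c)))

  count-at-distance-0 : ∀ {d} (a : Cube d) → cubeSum (λ b → ⟦ hamming a b ≡ᵇ 0 ⟧) ≡ 1
  count-at-distance-0         []          = refl
  count-at-distance-0 {suc d} (false ∷ a) = cong₂ _+_ (count-at-distance-0 a) (cubeSum-zero {d})
  count-at-distance-0 {suc d} (true  ∷ a) = cong₂ _+_ (cubeSum-zero {d}) (count-at-distance-0 a)

  degree : ∀ {d} (a : Cube d) → cubeSum (λ b → ⟦ adjacent a b ⟧) ≡ d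
  degree         []          = refl
  degree {suc d} (false ∷ a) = trans (cong₂ _+_ (degree a) (count-at-distance-0 a)) (+-comm d 1)
  degree {suc d} (true  ∷ a) = cong₂ _+_ (count-at-distance-0 a) (degree a)

  -- A Chernoff-type weighting: each coordinate where a and b agree contributes a factor 16,
  -- so that weight a b = 16 ^ (d ∸ hamming a b) and the total weight around a is 17 ^ d.
  bitWeight : Bool → Bool → ℕ
  bitWeight false false = 16
  bitWeight false true  = 1
  bitWeight true  false = 1
  bitWeight true  true  = 16

  weight : ∀ {d} → Cube d → Cube d → ℕ
  weight []      []      = 1
  weight (x ∷ a) (y ∷ b) = bitWeight x y * weight a b

  cubeSum-weight : ∀ {d} (a : Cube d) → cubeSum (weight a) ≡ 17 ^ d
  cubeSum-weight         []          = refl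
  cubeSum-weight {suc d} (x ∷ a) rewrite cubeSum-*ˡ (bitWeight x false) (weight a)
                                       | cubeSum-*ˡ (bitWeight x true) (weight a) | cubeSum-weight a = row x
    where
    row : ∀ x → bitWeight x false * 17 ^ d + bitWeight x true * 17 ^ d ≡ 17 * 17 ^ d
    row false = sym (*-distribʳ-+ (17 ^ d) 16 1)
    row true  = sym (*-distribʳ-+ (17 ^ d) 1 16)

  weight-*-16^hamming : ∀ {d} (a b : Cube d) → weight a b * 16 ^ hamming a b ≡ 16 ^ d
  weight-*-16^hamming         []      []      = refl
  weight-*-16^hamming {suc d} (x ∷ a) (y ∷ b) = begin
    bitWeight x y * weight a b * 16 ^ (bitDistance x y + hamming a b)
      ≡⟨ cong (bitWeight x y * weight a b *_) (^-distribˡ-+-* 16 (bitDistance x y) (hamming a b)) ⟩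
    bitWeight x y * weight a b * (16 ^ bitDistance x y * 16 ^ hamming a b)
      ≡⟨ interchange-* (bitWeight x y) (weight a b) (16 ^ bitDistance x y) (16 ^ hamming a b) ⟩
    (bitWeight x y * 16 ^ bitDistance x y) * (weight a b * 16 ^ hamming a b)
      ≡⟨ cong₂ _*_ (bit x y) (weight-*-16^hamming a b) ⟩
    16 * 16 ^ d ∎
    where
    open ≡-Reasoning
    interchange-* : ∀ p q r s → p * q * (r * s) ≡ (p * r) * (q * s)
    interchange-* = solve-∀
    bit : ∀ x y → bitWeight x y * 16 ^ bitDistance x y ≡ 16
    bit false false = refl
    bit false true  = refl
    bit true  false = refl
    bit true  true  = refl

  truncated-≤-weight : ∀ {d} D (a b : Cube d) → (D ∸ hamming a b) * 16 ^ d ≤ D * 16 ^ D * weight a b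
  truncated-≤-weight {d} D a b with hamming a b ≤? D
  ... | yes h≤D = begin
    (D ∸ hamming a b) * 16 ^ d                   ≡⟨ cong ((D ∸ hamming a b) *_) (weight-*-16^hamming a b) ⟨
    (D ∸ hamming a b) * (weight a b * 16 ^ hamming a b)
      ≤⟨ *-mono-≤ (m∸n≤m D (hamming a b)) (*-monoʳ-≤ (weight a b) (^-monoʳ-≤ 16 h≤D)) ⟩
    D * (weight a b * 16 ^ D)                    ≡⟨ reorder D (weight a b) (16 ^ D) ⟩
    D * 16 ^ D * weight a b                      ∎
    where
    open ≤-Reasoning
    reorder : ∀ p q r → p * (q * r) ≡ p * r * q
    reorder = solve-∀
  ... | no h≰D rewrite m≤n⇒m∸n≡0 (<⇒≤ (≰⇒> h≰D)) = z≤n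

  ball-bound : ∀ {d} D (a : Cube d) → 16 ^ d * cubeSum (λ b → D ∸ hamming a b) ≤ D * 16 ^ D * 17 ^ d
  ball-bound {d} D a = begin
    16 ^ d * cubeSum (λ b → D ∸ hamming a b)     ≡⟨ cubeSum-*ˡ (16 ^ d) (λ b → D ∸ hamming a b) ⟨
    cubeSum (λ b → 16 ^ d * (D ∸ hamming a b))
      ≤⟨ cubeSum-mono-≤ (λ b → ≤-trans (≤-reflexive (*-comm (16 ^ d) (D ∸ hamming a b))) (truncated-≤-weight D a b)) ⟩
    cubeSum (λ b → D * 16 ^ D * weight a b)      ≡⟨ cubeSum-*ˡ (D * 16 ^ D) (weight a) ⟩
    D * 16 ^ D * cubeSum (weight a)              ≡⟨ cong (D * 16 ^ D *_) (cubeSum-weight a) ⟩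
    D * 16 ^ D * 17 ^ d                          ∎
    where open ≤-Reasoning

  size : ∀ {d} → (Cube d → Bool) → ℕ
  size χ = cubeSum (λ a → ⟦ χ a ⟧)

  innerDegree : ∀ {d} → (Cube d → Bool) → Cube d → ℕ
  innerDegree χ a = cubeSum (λ b → ⟦ χ b ⟧ * ⟦ adjacent a b ⟧)

  innerEdges : ∀ {d} → (Cube d → Bool) → ℕ
  innerEdges χ = cubeSum (λ a → ⟦ χ a ⟧ * innerDegree χ a)

  innerEdges≤degree*size : ∀ {d} (χ : Cube d → Bool) → innerEdges χ ≤ d * size χ
  innerEdges≤degree*size {d} χ = begin
    innerEdges χ
      ≤⟨ cubeSum-mono-≤ (λ a → *-monoʳ-≤ ⟦ χ a ⟧
           (≤-trans (cubeSum-mono-≤ (λ b → ⟦⟧*≤ (χ b) _)) (≤-reflexive (degree a)))) ⟩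
    cubeSum (λ a → ⟦ χ a ⟧ * d)  ≡⟨ cubeSum-cong (λ a → *-comm ⟦ χ a ⟧ d) ⟩
    cubeSum (λ a → d * ⟦ χ a ⟧)  ≡⟨ cubeSum-*ˡ d (λ a → ⟦ χ a ⟧) ⟩
    d * size χ                   ∎
    where open ≤-Reasoning

  -- Between two opposite facets the cube's edges form a perfect matching: a in one facet is
  -- adjacent to b in the other iff hamming a b ≡ 0 in the remaining coordinates.
  crossEdges : ∀ {d} → (Cube d → Bool) → (Cube d → Bool) → ℕ
  crossEdges χ ψ = cubeSum (λ a → ⟦ χ a ⟧ * cubeSum (λ b → ⟦ ψ b ⟧ * ⟦ hamming a b ≡ᵇ 0 ⟧))

  crossEdges≤sizeˡ : ∀ {d} (χ ψ : Cube d → Bool) → crossEdges χ ψ ≤ size χ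
  crossEdges≤sizeˡ χ ψ = cubeSum-mono-≤ (λ a → ≤-trans (*-monoʳ-≤ ⟦ χ a ⟧
    (≤-trans (cubeSum-mono-≤ (λ b → ⟦⟧*≤ (ψ b) _)) (≤-reflexive (count-at-distance-0 a))))
    (≤-reflexive (*-identityʳ ⟦ χ a ⟧)))

  crossEdges≤sizeʳ : ∀ {d} (χ ψ : Cube d → Bool) → crossEdges χ ψ ≤ size ψ
  crossEdges≤sizeʳ χ ψ = begin
    crossEdges χ ψ
      ≤⟨ cubeSum-mono-≤ (λ a → ⟦⟧*≤ (χ a) _) ⟩
    cubeSum (λ a → cubeSum (λ b → ⟦ ψ b ⟧ * ⟦ hamming a b ≡ᵇ 0 ⟧))
      ≡⟨ cubeSum-comm (λ a b → ⟦ ψ b ⟧ * ⟦ hamming a b ≡ᵇ 0 ⟧) ⟩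
    cubeSum (λ b → cubeSum (λ a → ⟦ ψ b ⟧ * ⟦ hamming a b ≡ᵇ 0 ⟧))
      ≡⟨ cubeSum-cong (λ b → trans (cubeSum-*ˡ ⟦ ψ b ⟧ (λ a → ⟦ hamming a b ≡ᵇ 0 ⟧))
           (trans (cong (⟦ ψ b ⟧ *_) (trans (cubeSum-cong (λ a → cong (λ h → ⟦ h ≡ᵇ 0 ⟧) (hamming-sym a b)))
                                            (count-at-distance-0 b)))
                  (*-identityʳ ⟦ ψ b ⟧))) ⟩
    size ψ ∎
    where open ≤-Reasoning

  cubeSum-*-distrib-+ : ∀ {d} (c f g : Cube d → ℕ) →
    cubeSum (λ a → c a * (f a + g a)) ≡ cubeSum (λ a → c a * f a) + cubeSum (λ a → c a * g a)
  cubeSum-*-distrib-+ c f g = trans (cubeSum-cong (λ a → *-distribˡ-+ (c a) (f a) (g a)))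
                                    (cubeSum-distrib-+ (λ a → c a * f a) (λ a → c a * g a))

  innerEdges-split : ∀ {d} (χ : Cube (suc d) → Bool) →
    innerEdges χ ≡ (innerEdges (λ v → χ (false ∷ v)) + crossEdges (λ v → χ (false ∷ v)) (λ v → χ (true ∷ v)))
                 + (crossEdges (λ v → χ (true ∷ v)) (λ v → χ (false ∷ v)) + innerEdges (λ v → χ (true ∷ v)))
  innerEdges-split χ = cong₂ _+_
    (cubeSum-*-distrib-+ (λ a → ⟦ χ₀ a ⟧) (innerDegree χ₀) (λ a → cubeSum (λ b → ⟦ χ₁ b ⟧ * ⟦ hamming a b ≡ᵇ 0 ⟧)))
    (cubeSum-*-distrib-+ (λ a → ⟦ χ₁ a ⟧) (λ a → cubeSum (λ b → ⟦ χ₀ b ⟧ * ⟦ hamming a b ≡ᵇ 0 ⟧)) (innerDegree χ₁))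
    where
    χ₀ χ₁ : Cube _ → Bool
    χ₀ v = χ (false ∷ v)
    χ₁ v = χ (true ∷ v)

  -- Split χ into its facets χ₀, χ₁; the matching between them contributes at most
  -- min (size χ₀) (size χ₁) edges each way.  If both facets are below 2 ^ (K - 1), apply
  -- induction at K - 1 and pay size χ for the matching; otherwise the smaller facet is below
  -- 2 ^ (K - 1) and its saving pays for the matching.
  isoperimetric : ∀ {d} (χ : Cube d → Bool) K → size χ ≤ 2 ^ K → innerEdges χ ≤ 2 * K * size χ
  isoperimetric {zero} χ K _ with χ []
  ... | true  = z≤n
  ... | false = z≤n
  isoperimetric {suc d} χ K size≤ = ≤-trans (≤-reflexive (innerEdges-split χ)) (bound K size≤)
    where
    χ₀ χ₁ : Cube d → Bool
    χ₀ v = χ (false ∷ v)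
    χ₁ v = χ (true ∷ v)
    s₀ = size χ₀
    s₁ = size χ₁
    +-mono₄-≤ : ∀ {a b c e a′ b′ c′ e′} → a ≤ a′ → b ≤ b′ → c ≤ c′ → e ≤ e′ →
                (a + b) + (c + e) ≤ (a′ + b′) + (c′ + e′)
    +-mono₄-≤ p q r s = +-mono-≤ (+-mono-≤ p q) (+-mono-≤ r s)
    bound : ∀ K → s₀ + s₁ ≤ 2 ^ K →
            (innerEdges χ₀ + crossEdges χ₀ χ₁) + (crossEdges χ₁ χ₀ + innerEdges χ₁) ≤ 2 * K * (s₀ + s₁)
    bound zero s≤1 = +-mono₄-≤
      (isoperimetric χ₀ 0 (≤-trans (m≤m+n s₀ s₁) s≤1))
      (≤both⇒≤0 s≤1 (crossEdges≤sizeˡ χ₀ χ₁) (crossEdges≤sizeʳ χ₀ χ₁))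
      (≤both⇒≤0 s≤1 (crossEdges≤sizeʳ χ₁ χ₀) (crossEdges≤sizeˡ χ₁ χ₀))
      (isoperimetric χ₁ 0 (≤-trans (m≤n+m s₁ s₀) s≤1))
    bound (suc K) s≤2^K with s₀ ≤? 2 ^ K | s₁ ≤? 2 ^ K
    ... | yes s₀≤ | yes s₁≤ = ≤-trans
      (+-mono₄-≤ (isoperimetric χ₀ K s₀≤) (crossEdges≤sizeˡ χ₀ χ₁) (crossEdges≤sizeˡ χ₁ χ₀) (isoperimetric χ₁ K s₁≤))
      (≤-trans (m≤m+n _ (s₀ + s₁)) (≤-reflexive (both-small K s₀ s₁)))
      where
      both-small : ∀ k a b → 2 * k * a + a + (b + 2 * k * b) + (a + b) ≡ 2 * suc k * (a + b)
      both-small = solve-∀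
    ... | no s₀≰ | _ = ≤-trans
      (+-mono₄-≤ (isoperimetric χ₀ (suc K) (≤-trans (m≤m+n s₀ s₁) s≤2^K)) (crossEdges≤sizeʳ χ₀ χ₁)
                 (crossEdges≤sizeˡ χ₁ χ₀) (isoperimetric χ₁ K (other-half-small (≰⇒> s₀≰) s≤2^K)))
      (≤-reflexive (first-large K s₀ s₁))
      where
      first-large : ∀ k a b → 2 * suc k * a + b + (b + 2 * k * b) ≡ 2 * suc k * (a + b)
      first-large = solve-∀
    ... | yes s₀≤ | no s₁≰ = ≤-trans
      (+-mono₄-≤ (isoperimetric χ₀ K s₀≤) (crossEdges≤sizeˡ χ₀ χ₁) (crossEdges≤sizeʳ χ₁ χ₀)
                 (isoperimetric χ₁ (suc K) (≤-trans (m≤n+m s₁ s₀) s≤2^K)))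
      (≤-reflexive (second-large K s₀ s₁))
      where
      second-large : ∀ k a b → 2 * k * a + a + (a + 2 * suc k * b) ≡ 2 * suc k * (a + b)
      second-large = solve-∀


module HypercubeGraph where

  open import Data.Nat as ℕ using (ℕ; zero; suc; _+_; _≤_; _≡ᵇ_; _^_)
  open import Data.Nat.Properties
  open import Data.Bool using (true; false)
  open import Data.Bool.Properties using () renaming (_≟_ to _≟ᵇ_)
  open import Data.Vec using ([]; _∷_; replicate)
  open import Data.Fin using (Fin; _↑ˡ_; _↑ʳ_; splitAt)
  open import Data.Fin.Properties using (splitAt-↑ˡ; splitAt-↑ʳ; join-splitAt)
  open import Data.Sum using (inj₁; inj₂; [_,_]′)
  open import Relation.Nullary using (¬_; yes; no; contradiction)
  open import Relation.Binary.PropositionalEquality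
  open import Data.Nat.Logarithm using (⌊log₂_⌋; ⌊log₂[2^n]⌋≡n)
  open import Data.Rational using (0ℚ; 1ℚ; _<_)
  open import Defs using (Graph; Walk; here; step; Connected; LPFeasible; cost)
  open FinSums using (sum; squareSum)
  open Positivity using (cost-pos-on-induced-path)
  open Hypercube

  index : ∀ {d} → Cube d → Fin (cubeSize d)
  index {zero}  []          = Fin.zero
  index {suc d} (false ∷ v) = index v ↑ˡ cubeSize d
  index {suc d} (true  ∷ v) = cubeSize d ↑ʳ index v

  vertex : ∀ d → Fin (cubeSize d) → Cube d
  vertex zero    _ = []
  vertex (suc d) i = [ (λ j → false ∷ vertex d j) , (λ j → true ∷ vertex d j) ]′ (splitAt (cubeSize d) i)

  vertex-index : ∀ {d} (v : Cube d) → vertex d (index v) ≡ v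
  vertex-index {zero}  []          = refl
  vertex-index {suc d} (false ∷ v) rewrite splitAt-↑ˡ (cubeSize d) (index v) (cubeSize d) = cong (false ∷_) (vertex-index v)
  vertex-index {suc d} (true  ∷ v) rewrite splitAt-↑ʳ (cubeSize d) (cubeSize d) (index v) = cong (true ∷_) (vertex-index v)

  index-vertex : ∀ d (i : Fin (cubeSize d)) → index (vertex d i) ≡ i
  index-vertex zero    Fin.zero = refl
  index-vertex (suc d) i with splitAt (cubeSize d) i | join-splitAt (cubeSize d) (cubeSize d) i
  ... | inj₁ j | join≡i = trans (cong (_↑ˡ cubeSize d) (index-vertex d j)) join≡i
  ... | inj₂ j | join≡i = trans (cong (cubeSize d ↑ʳ_) (index-vertex d j)) join≡i

  index-injective : ∀ {d} {a b : Cube d} → ¬ a ≡ b → ¬ index a ≡ index b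
  index-injective {a = a} {b} a≢b ia≡ib = a≢b (trans (sym (vertex-index a)) (trans (cong (vertex _) ia≡ib) (vertex-index b)))

  sum-split : ∀ a {b} (f : Fin (a + b) → ℕ) → sum f ≡ sum (λ i → f (i ↑ˡ b)) + sum (λ j → f (a ↑ʳ j))
  sum-split zero        f = refl
  sum-split (suc a) {b} f = trans (cong (f Fin.zero +_) (sum-split a (λ i → f (Fin.suc i))))
                                  (sym (+-assoc (f Fin.zero) _ _))

  sum-index : ∀ d (f : Fin (cubeSize d) → ℕ) → sum f ≡ cubeSum {d} (λ v → f (index v))
  sum-index zero    f = +-identityʳ (f Fin.zero)
  sum-index (suc d) f = trans (sum-split (cubeSize d) f)
    (cong₂ _+_ (sum-index d (λ i → f (i ↑ˡ cubeSize d))) (sum-index d (λ j → f (cubeSize d ↑ʳ j))))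

  hypercube : ∀ d → Graph (cubeSize d)
  hypercube d = record
    { adj   = λ i j → adjacent (vertex d i) (vertex d j)
    ; sym   = λ i j → cong (_≡ᵇ 1) (hamming-sym (vertex d i) (vertex d j))
    ; irref = λ i → cong (_≡ᵇ 1) (hamming-self (vertex d i))
    }

  adj-hypercube-index : ∀ {d} (a b : Cube d) → Graph.adj (hypercube d) (index a) (index b) ≡ adjacent a b
  adj-hypercube-index a b = cong₂ adjacent (vertex-index a) (vertex-index b)

  -- To reach y ∷ b from x ∷ a, first move inside the facet x from a to b, then flip the first bit.
  cube-walk-induction : ∀ {d} (P : Cube d → Cube d → Set) → (∀ a → P a a) →
                        (∀ a c b → adjacent a c ≡ true → P c b → P a b) → ∀ a b → P a b
  cube-walk-induction {zero}  P refl-P step-P [] [] = refl-P []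
  cube-walk-induction {suc d} P refl-P step-P (x ∷ a) (y ∷ b) =
    cube-walk-induction Q (λ _ p → p) step-Q a b flip
    where
    Q : Cube d → Cube d → Set
    Q a′ b′ = P (x ∷ b′) (y ∷ b) → P (x ∷ a′) (y ∷ b)
    step-Q : ∀ a′ c′ b′ → adjacent a′ c′ ≡ true → Q c′ b′ → Q a′ b′
    step-Q a′ c′ b′ a′c′ q p = step-P (x ∷ a′) (x ∷ c′) (y ∷ b) (same-facet x a′c′) (q p)
      where
      same-facet : ∀ x → adjacent a′ c′ ≡ true → adjacent (x ∷ a′) (x ∷ c′) ≡ true
      same-facet false a′c′ = a′c′
      same-facet true  a′c′ = a′c′
    flip : P (x ∷ b) (y ∷ b)
    flip with x ≟ᵇ y
    ... | yes refl = refl-P (x ∷ b)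
    ... | no  x≢y  = step-P (x ∷ b) (y ∷ b) (y ∷ b) (across x y x≢y) (refl-P (y ∷ b))
      where
      across : ∀ x y → ¬ x ≡ y → adjacent (x ∷ b) (y ∷ b) ≡ true
      across false false x≢y = contradiction refl x≢y
      across false true  _   = cong (_≡ᵇ 0) (hamming-self b)
      across true  false _   = cong (_≡ᵇ 0) (hamming-self b)
      across true  true  x≢y = contradiction refl x≢y

  hypercube-connected : ∀ d → Connected (hypercube d)
  hypercube-connected d u v = subst₂ (Walk (hypercube d)) (index-vertex d u) (index-vertex d v)
    (cube-walk-induction (λ a b → Walk (hypercube d) (index a) (index b)) (λ a → here)
      (λ a c b ac walk → step (trans (adj-hypercube-index a c) ac) walk) (vertex d u) (vertex d v))

  cubeSize≡2^ : ∀ d → cubeSize d ≡ 2 ^ d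
  cubeSize≡2^ zero    = refl
  cubeSize≡2^ (suc d) rewrite cubeSize≡2^ d = cong (2 ^ d +_) (sym (+-identityʳ (2 ^ d)))

  d<cubeSize : ∀ d → d ℕ.< cubeSize d
  d<cubeSize zero    = ≤-refl
  d<cubeSize (suc d) = +-mono-≤ (≤-trans (ℕ.s≤s ℕ.z≤n) (d<cubeSize d)) (d<cubeSize d)


  ⌊log₂cubeSize⌋≡d : ∀ d → ⌊log₂ cubeSize d ⌋ ≡ d
  ⌊log₂cubeSize⌋≡d d = trans (cong ⌊log₂_⌋ (cubeSize≡2^ d)) (⌊log₂[2^n]⌋≡n d)

  squareSum-index : ∀ d (g : Fin (cubeSize d) → Fin (cubeSize d) → ℕ) →
                    squareSum g ≡ cubeSum {d} (λ a → cubeSum {d} (λ b → g (index a) (index b)))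
  squareSum-index d g = trans (sum-index d (λ i → sum (g i))) (cubeSum-cong (λ a → sum-index d (g (index {d} a))))

  hypercube-cost-pos : ∀ d → 2 ≤ d → ∀ {lam} → 0ℚ < lam → lam < 1ℚ →
                       ∀ z → LPFeasible z → 0ℚ < cost (hypercube d) lam z
  hypercube-cost-pos (suc (suc e)) (ℕ.s≤s (ℕ.s≤s ℕ.z≤n)) 0<lam lam<1 =
    cost-pos-on-induced-path (hypercube (suc (suc e))) 0<lam lam<1
      (index-injective {a = a₀} {b = a₁} (λ ())) (index-injective {a = a₀} {b = a₂} (λ ()))
      (index-injective {a = a₂} {b = a₁} (λ ()))
      (trans (adj-hypercube-index a₀ a₁) (cong (λ h → suc h ≡ᵇ 1) (hamming-self 0ᵉ)))
      (trans (adj-hypercube-index a₂ a₁) (cong (λ h → suc h ≡ᵇ 1) (hamming-self 0ᵉ)))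
      (adj-hypercube-index a₀ a₂)
    where
    0ᵉ : Cube e
    0ᵉ = replicate e false
    a₀ a₁ a₂ : Cube (suc (suc e))
    a₀ = false ∷ false ∷ 0ᵉ
    a₁ = true  ∷ false ∷ 0ᵉ
    a₂ = true  ∷ true  ∷ 0ᵉ


module ClusterCosts where

  open import Data.Nat using (ℕ; zero; suc; _+_; _*_; _≤_)
  open import Data.Nat.Properties hiding (_≟_)
  open import Data.Nat.Tactic.RingSolver using (solve-∀)
  open import Data.Bool using (Bool; true; false)
  open import Data.Fin using (Fin)
  open import Data.Fin.Properties using (_≟_)
  open import Relation.Nullary using (does; yes; no; contradiction)
  open import Relation.Binary.PropositionalEquality
  open FinSums using (sum; sum-cong-≗; sum-mono-≤; *-distribʳ-sum; sum-replicate-zero)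
  open ScaledCosts using (disagreement)
  open Hypercube

  disagreement-identity : ∀ A B same edge →
    disagreement A B same edge + (A + B) * (⟦ same ⟧ * ⟦ edge ⟧) ≡ A * ⟦ edge ⟧ + B * ⟦ same ⟧
  disagreement-identity A B true  true  = identity A B
    where identity : ∀ A B → 0 + (A + B) * (1 * 1) ≡ A * 1 + B * 1
          identity = solve-∀
  disagreement-identity A B true  false = identity A B
    where identity : ∀ A B → B + (A + B) * (1 * 0) ≡ A * 0 + B * 1
          identity = solve-∀
  disagreement-identity A B false true  = identity A B
    where identity : ∀ A B → A + (A + B) * (0 * 1) ≡ A * 1 + B * 0
          identity = solve-∀
  disagreement-identity A B false false = identity A B
    where identity : ∀ A B → 0 + (A + B) * (0 * 0) ≡ A * 0 + B * 0
          identity = solve-∀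

  module _ {d : ℕ} (A B : ℕ) where

    costAt : (Cube d → Bool) → Cube d → ℕ
    costAt χ a = cubeSum (λ b → disagreement A B (χ b) (adjacent a b))

    clusterCost : (Cube d → Bool) → ℕ
    clusterCost χ = cubeSum (λ a → ⟦ χ a ⟧ * costAt χ a)

    costAt-identity : ∀ χ a → costAt χ a + (A + B) * innerDegree χ a ≡ A * d + B * size χ
    costAt-identity χ a = begin
      costAt χ a + (A + B) * innerDegree χ a
        ≡⟨ cong (costAt χ a +_) (cubeSum-*ˡ (A + B) (λ b → ⟦ χ b ⟧ * ⟦ adjacent a b ⟧)) ⟨
      costAt χ a + cubeSum (λ b → (A + B) * (⟦ χ b ⟧ * ⟦ adjacent a b ⟧))
        ≡⟨ cubeSum-distrib-+ (λ b → disagreement A B (χ b) (adjacent a b))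
                             (λ b → (A + B) * (⟦ χ b ⟧ * ⟦ adjacent a b ⟧)) ⟨
      cubeSum (λ b → disagreement A B (χ b) (adjacent a b) + (A + B) * (⟦ χ b ⟧ * ⟦ adjacent a b ⟧))
        ≡⟨ cubeSum-cong (λ b → disagreement-identity A B (χ b) (adjacent a b)) ⟩
      cubeSum (λ b → A * ⟦ adjacent a b ⟧ + B * ⟦ χ b ⟧)
        ≡⟨ cubeSum-distrib-+ (λ b → A * ⟦ adjacent a b ⟧) (λ b → B * ⟦ χ b ⟧) ⟩
      cubeSum (λ b → A * ⟦ adjacent a b ⟧) + cubeSum (λ b → B * ⟦ χ b ⟧)
        ≡⟨ cong₂ _+_ (trans (cubeSum-*ˡ A (λ b → ⟦ adjacent a b ⟧)) (cong (A *_) (degree a)))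
                     (cubeSum-*ˡ B (λ b → ⟦ χ b ⟧)) ⟩
      A * d + B * size χ ∎
      where open ≡-Reasoning

    clusterCost-identity : ∀ χ → clusterCost χ + (A + B) * innerEdges χ ≡ size χ * (A * d + B * size χ)
    clusterCost-identity χ = begin
      clusterCost χ + (A + B) * innerEdges χ
        ≡⟨ cong (clusterCost χ +_) (cubeSum-*ˡ (A + B) (λ a → ⟦ χ a ⟧ * innerDegree χ a)) ⟨
      clusterCost χ + cubeSum (λ a → (A + B) * (⟦ χ a ⟧ * innerDegree χ a))
        ≡⟨ cubeSum-distrib-+ (λ a → ⟦ χ a ⟧ * costAt χ a) (λ a → (A + B) * (⟦ χ a ⟧ * innerDegree χ a)) ⟨
      cubeSum (λ a → ⟦ χ a ⟧ * costAt χ a + (A + B) * (⟦ χ a ⟧ * innerDegree χ a))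
        ≡⟨ cubeSum-cong (λ a → trans (factor ⟦ χ a ⟧ (costAt χ a) (A + B) (innerDegree χ a))
                                     (cong (⟦ χ a ⟧ *_) (costAt-identity χ a))) ⟩
      cubeSum (λ a → ⟦ χ a ⟧ * (A * d + B * size χ))
        ≡⟨ cubeSum-cong (λ a → *-comm ⟦ χ a ⟧ (A * d + B * size χ)) ⟩
      cubeSum (λ a → (A * d + B * size χ) * ⟦ χ a ⟧)
        ≡⟨ cubeSum-*ˡ (A * d + B * size χ) (λ a → ⟦ χ a ⟧) ⟩
      (A * d + B * size χ) * size χ
        ≡⟨ *-comm (A * d + B * size χ) (size χ) ⟩
      size χ * (A * d + B * size χ) ∎
      where
      open ≡-Reasoning
      factor : ∀ c y k q → c * y + k * (c * q) ≡ c * (y + k * q)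
      factor = solve-∀

  does-≟-sym : ∀ {m} (x y : Fin m) → does (x ≟ y) ≡ does (y ≟ x)
  does-≟-sym x y with x ≟ y | y ≟ x
  ... | yes _   | yes _   = refl
  ... | no  _   | no  _   = refl
  ... | yes x≡y | no  y≢x = contradiction (sym x≡y) y≢x
  ... | no  x≢y | yes y≡x = contradiction (sym y≡x) x≢y

  label-count : ∀ {m} (x : Fin m) → sum (λ l → ⟦ does (x ≟ l) ⟧) ≡ 1
  label-count {suc m} Fin.zero    = cong suc (sum-replicate-zero m)
  label-count {suc m} (Fin.suc x) = label-count x

  module _ {d m : ℕ} (A B : ℕ) (ℓ : Cube d → Fin m) where

    cluster : Fin m → Cube d → Bool
    cluster l a = does (ℓ a ≟ l)

    labellingCost : ℕ
    labellingCost = cubeSum (λ a → cubeSum (λ b → disagreement A B (does (ℓ a ≟ ℓ b)) (adjacent a b)))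

    labellingCost≡sum-clusterCost : labellingCost ≡ sum (λ l → clusterCost A B (cluster l))
    labellingCost≡sum-clusterCost = begin
      cubeSum rowCost
        ≡⟨ cubeSum-cong (λ a → trans (cong (_* rowCost a) (label-count (ℓ a))) (+-identityʳ (rowCost a))) ⟨
      cubeSum (λ a → sum (λ l → ⟦ cluster l a ⟧) * rowCost a)
        ≡⟨ cubeSum-cong (λ a → *-distribʳ-sum (rowCost a) (λ l → ⟦ cluster l a ⟧)) ⟩
      cubeSum (λ a → sum (λ l → ⟦ cluster l a ⟧ * rowCost a))
        ≡⟨ cubeSum-sum-comm (λ a l → ⟦ cluster l a ⟧ * rowCost a) ⟩
      sum (λ l → cubeSum (λ a → ⟦ cluster l a ⟧ * rowCost a))
        ≡⟨ sum-cong-≗ (λ l → cubeSum-cong (rowCost-in-cluster l)) ⟩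
      sum (λ l → clusterCost A B (cluster l)) ∎
      where
      open ≡-Reasoning
      rowCost : Cube d → ℕ
      rowCost a = cubeSum (λ b → disagreement A B (does (ℓ a ≟ ℓ b)) (adjacent a b))
      rowCost-in-cluster : ∀ l a → ⟦ cluster l a ⟧ * rowCost a ≡ ⟦ cluster l a ⟧ * costAt A B (cluster l) a
      rowCost-in-cluster l a with ℓ a ≟ l
      ... | no  _    = refl
      ... | yes refl = cong (1 *_) (cubeSum-cong (λ b →
                         cong (λ same → disagreement A B same (adjacent a b)) (does-≟-sym (ℓ a) (ℓ b))))

    labellingCost-≥ : ∀ L → (∀ χ → size χ * L ≤ clusterCost A B χ) → cubeSize d * L ≤ labellingCost
    labellingCost-≥ L cluster-≥ = begin
      cubeSize d * L
        ≡⟨ cong (_* L) (trans (cubeSum-cong (λ a → label-count (ℓ a))) (trans (cubeSum-const {d} 1) (*-identityʳ (cubeSize d)))) ⟨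
      cubeSum (λ a → sum (λ l → ⟦ cluster l a ⟧)) * L
        ≡⟨ cong (_* L) (cubeSum-sum-comm (λ a l → ⟦ cluster l a ⟧)) ⟩
      sum (λ l → size (cluster l)) * L
        ≡⟨ *-distribʳ-sum L (λ l → size (cluster l)) ⟩
      sum (λ l → size (cluster l) * L)
        ≤⟨ sum-mono-≤ (λ l → cluster-≥ (cluster l)) ⟩
      sum (λ l → clusterCost A B (cluster l))
        ≡⟨ labellingCost≡sum-clusterCost ⟨
      labellingCost ∎
      where open ≤-Reasoning


module Construction (u : ℕ) where

  open import Data.Nat using (ℕ; suc; _+_; _*_; _≤_; _<_; z≤n; s≤s; _∸_; _^_; _⊓_; NonZero)
  open import Data.Nat.Properties hiding (_≟_)
  open import Data.Nat.Tactic.RingSolver using (solve-∀)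
  open import Data.Nat.Logarithm using (⌊log₂_⌋)
  import Data.Integer as ℤ
  open import Data.Rational as ℚ using (ℚ; 0ℚ; 1ℚ)
  import Data.Rational.Properties as ℚ
  open import Data.Rational.Solver using (module +-*-Solver)
  open import Data.Bool using (Bool; true; false; T)
  open import Data.Fin using (Fin)
  open import Data.Fin.Properties using (_≟_)
  open import Data.Product using (_,_)
  open import Data.Sum using (inj₁; inj₂)
  open import Data.Unit using (tt)
  open import Relation.Nullary using (Dec; does; yes; no)
  open import Relation.Binary.PropositionalEquality
  open import Defs using (Graph; adj; LPFeasible; cost; ipCost; Clustering)
  open NatEmbedding
  open NatFacts
  open FinSums using (sum; sum-mono-≤; upperSum; diagonalSum; squareSum; squareSum-symmetric)
  open Positivity using (*-nonNeg)
  open ScaledCosts using (disagreement; fractionalDisagreement; cost-scaled; ipCost-scaled)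
  open Hypercube
  open HypercubeGraph
  open ClusterCosts

  t d M K A L : ℕ
  t = suc u
  d = 20 * t
  M = 64 ^ t
  K = M * t
  A = K ∸ t
  L = t * (A + t)

  64≤M : 64 ≤ M
  64≤M = ≤-trans (≤-reflexive (sym (*-identityʳ 64))) (*-monoʳ-≤ 64 (^-monoʳ-≤ 64 {0} {u} z≤n))

  t≤K : t ≤ K
  t≤K = ≤-trans (≤-reflexive (sym (*-identityˡ t))) (*-monoˡ-≤ t (≤-trans (s≤s z≤n) 64≤M))

  A+t≡K : A + t ≡ K
  A+t≡K = m∸n+n≡m t≤K

  19t²≤tA : 19 * (t * t) ≤ t * A
  19t²≤tA = +-cancelʳ-≤ (t * t) (19 * (t * t)) (t * A) (begin
    19 * (t * t) + t * t    ≡⟨ +-comm (19 * (t * t)) (t * t) ⟩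
    20 * (t * t)            ≤⟨ *-monoˡ-≤ (t * t) (≤-trans (m≤m+n 20 44) 64≤M) ⟩
    M * (t * t)             ≡⟨ regroup M t ⟩
    t * K                   ≡⟨ cong (t *_) A+t≡K ⟨
    t * (A + t)             ≡⟨ *-distribˡ-+ t A t ⟩
    t * A + t * t           ∎)
    where
    open ≤-Reasoning
    regroup : ∀ M t → M * (t * t) ≡ t * (M * t)
    regroup = solve-∀

  A+21t≤2^9t : A + 21 * t ≤ 2 ^ (9 * t)
  A+21t≤2^9t = begin
    A + 21 * t          ≡⟨ +-assoc A t (20 * t) ⟨
    (A + t) + 20 * t    ≡⟨ cong (_+ 20 * t) A+t≡K ⟩
    M * t + 20 * t      ≤⟨ +-monoʳ-≤ (M * t) (*-monoˡ-≤ t (≤-trans (m≤m+n 20 44) 64≤M)) ⟩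
    M * t + M * t       ≡⟨ double M t ⟩
    (2 * t) * M         ≤⟨ *-monoˡ-≤ M (2n≤8^n t) ⟩
    8 ^ t * 64 ^ t      ≡⟨ ^-distribʳ-* 8 64 t ⟨
    512 ^ t             ≡⟨ ^-*-assoc 2 9 t ⟩
    2 ^ (9 * t)         ∎
    where
    open ≤-Reasoning
    double : ∀ M t → M * t + M * t ≡ (2 * t) * M
    double = solve-∀

  -- Small clusters have few inner edges by the isoperimetric inequality, while a large
  -- cluster pays for its many non-adjacent inner pairs.
  clusterCost-≥ : (χ : Cube d → Bool) → size χ * L ≤ clusterCost A t χ
  clusterCost-≥ χ = +-cancelʳ-≤ ((A + t) * innerEdges χ) (s * L) (clusterCost A t χ)
    (≤-trans (bound (s ≤? 2 ^ (9 * t))) (≤-reflexive (sym (clusterCost-identity A t χ))))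
    where
    s = size χ
    open ≤-Reasoning
    bound : Dec (s ≤ 2 ^ (9 * t)) → s * L + (A + t) * innerEdges χ ≤ s * (A * d + t * s)
    bound (yes small) = begin
      s * L + (A + t) * innerEdges χ
        ≤⟨ +-monoʳ-≤ (s * L) (*-monoʳ-≤ (A + t) (isoperimetric χ (9 * t) small)) ⟩
      s * L + (A + t) * (2 * (9 * t) * s)          ≡⟨ expand s t A ⟩
      s * (19 * (t * t) + 19 * (t * A))            ≤⟨ *-monoʳ-≤ s (+-monoˡ-≤ (19 * (t * A)) 19t²≤tA) ⟩
      s * (t * A + 19 * (t * A))                   ≡⟨ cong (s *_) (collect t A) ⟩
      s * (A * d)                                  ≤⟨ *-monoʳ-≤ s (m≤m+n (A * d) (t * s)) ⟩
      s * (A * d + t * s)                          ∎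
      where
      expand : ∀ s t A → s * (t * (A + t)) + (A + t) * (2 * (9 * t) * s) ≡ s * (19 * (t * t) + 19 * (t * A))
      expand = solve-∀
      collect : ∀ t A → t * A + 19 * (t * A) ≡ A * (20 * t)
      collect = solve-∀
    bound (no large) = begin
      s * L + (A + t) * innerEdges χ
        ≤⟨ +-monoʳ-≤ (s * L) (*-monoʳ-≤ (A + t) (innerEdges≤degree*size χ)) ⟩
      s * L + (A + t) * (d * s)                    ≡⟨ expand s t A ⟩
      s * (A * d + t * (A + 21 * t))
        ≤⟨ *-monoʳ-≤ s (+-monoʳ-≤ (A * d) (*-monoʳ-≤ t (≤-trans A+21t≤2^9t (<⇒≤ (≰⇒> large))))) ⟩
      s * (A * d + t * s)                          ∎
      where
      expand : ∀ s t A → s * (t * (A + t)) + (A + t) * (20 * t * s) ≡ s * (A * (20 * t) + t * (A + 21 * t))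
      expand = solve-∀

  ball-bound-t : (a : Cube d) → cubeSum (λ b → t ∸ hamming a b) ≤ t * M
  ball-bound-t a = *-cancelˡ-≤ (16 ^ d) {{m^n≢0 16 d}} (≤-trans (ball-bound t a) (begin
    t * 16 ^ t * 17 ^ d                   ≡⟨ cong (t * 16 ^ t *_) (^-*-assoc 17 20 t) ⟨
    t * 16 ^ t * (17 ^ 20) ^ t            ≤⟨ *-monoʳ-≤ (t * 16 ^ t) (^-monoˡ-≤ t 17^20≤64*16^19) ⟩
    t * 16 ^ t * (64 * 16 ^ 19) ^ t       ≡⟨ cong (t * 16 ^ t *_) (trans (^-distribʳ-* 64 (16 ^ 19) t)
                                                                        (cong (M *_) (^-*-assoc 16 19 t))) ⟩
    t * 16 ^ t * (M * 16 ^ (19 * t))      ≡⟨ regroup t (16 ^ t) (16 ^ (19 * t)) M ⟩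
    (16 ^ t * 16 ^ (19 * t)) * (t * M)    ≡⟨ cong (_* (t * M)) (^-distribˡ-+-* 16 t (19 * t)) ⟨
    16 ^ d * (t * M)                      ∎))
    where
    open ≤-Reasoning
    17^20≤64*16^19 : 17 ^ 20 ≤ 64 * 16 ^ 19
    17^20≤64*16^19 = ≤ᵇ⇒≤ (17 ^ 20) (64 * 16 ^ 19) tt
    regroup : ∀ t x y M → t * x * (M * y) ≡ (x * y) * (t * M)
    regroup = solve-∀

  distance : Cube d → Cube d → ℕ
  distance a b = M * (t ⊓ hamming a b)

  distance≤K : ∀ a b → distance a b ≤ K
  distance≤K a b = *-monoʳ-≤ M (m⊓n≤m t (hamming a b))

  lpWeight : Cube d → Cube d → ℕ
  lpWeight a b = fractionalDisagreement A t K (adjacent a b) (distance a b)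

  lpWeight-≤ : ∀ a b → lpWeight a b ≤ K * M * ⟦ adjacent a b ⟧ + t * M * (t ∸ hamming a b)
  lpWeight-≤ a b with adjacent a b in ab
  ... | true  = begin
    A * (M * (t ⊓ hamming a b))   ≤⟨ *-mono-≤ (m∸n≤m K t) (*-monoʳ-≤ M (≤-trans (m⊓n≤n t (hamming a b)) (≤-reflexive h≡1))) ⟩
    K * (M * 1)                   ≡⟨ *-assoc K M 1 ⟨
    K * M * 1                     ≤⟨ m≤m+n (K * M * 1) (t * M * (t ∸ hamming a b)) ⟩
    K * M * 1 + t * M * (t ∸ hamming a b) ∎
    where
    open ≤-Reasoning
    h≡1 : hamming a b ≡ 1
    h≡1 = ≡ᵇ⇒≡ (hamming a b) 1 (subst T (sym ab) tt)
  ... | false = begin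
    t * (M * t ∸ M * (t ⊓ hamming a b))   ≡⟨ cong (t *_) (*-distribˡ-∸ M t (t ⊓ hamming a b)) ⟨
    t * (M * (t ∸ t ⊓ hamming a b))       ≤⟨ *-monoʳ-≤ t (*-monoʳ-≤ M (t∸t⊓h≤t∸h (hamming a b))) ⟩
    t * (M * (t ∸ hamming a b))           ≡⟨ *-assoc t M _ ⟨
    t * M * (t ∸ hamming a b)             ≤⟨ m≤n+m _ (K * M * 0) ⟩
    K * M * 0 + t * M * (t ∸ hamming a b) ∎
    where
    open ≤-Reasoning
    t∸t⊓h≤t∸h : ∀ h → t ∸ t ⊓ h ≤ t ∸ h
    t∸t⊓h≤t∸h h with ≤-total h t
    ... | inj₁ h≤t rewrite m≥n⇒m⊓n≡n h≤t = ≤-refl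
    ... | inj₂ t≤h rewrite m≤n⇒m⊓n≡m t≤h | n∸n≡0 t = z≤n

  rowLpWeight : Cube d → ℕ
  rowLpWeight a = cubeSum (lpWeight a)

  rowBound : ℕ
  rowBound = K * M * d + t * M * (t * M)

  rowLpWeight-≤ : ∀ a → rowLpWeight a ≤ rowBound
  rowLpWeight-≤ a = begin
    cubeSum (lpWeight a)
      ≤⟨ cubeSum-mono-≤ (lpWeight-≤ a) ⟩
    cubeSum (λ b → K * M * ⟦ adjacent a b ⟧ + t * M * (t ∸ hamming a b))
      ≡⟨ cubeSum-distrib-+ (λ b → K * M * ⟦ adjacent a b ⟧) (λ b → t * M * (t ∸ hamming a b)) ⟩
    cubeSum (λ b → K * M * ⟦ adjacent a b ⟧) + cubeSum (λ b → t * M * (t ∸ hamming a b))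
      ≡⟨ cong₂ _+_ (trans (cubeSum-*ˡ (K * M) (λ b → ⟦ adjacent a b ⟧)) (cong (K * M *_) (degree a)))
                   (cubeSum-*ˡ (t * M) (λ b → t ∸ hamming a b)) ⟩
    K * M * d + t * M * cubeSum (λ b → t ∸ hamming a b)
      ≤⟨ +-monoʳ-≤ (K * M * d) (*-monoʳ-≤ (t * M) (ball-bound-t a)) ⟩
    K * M * d + t * M * (t * M) ∎
    where open ≤-Reasoning

  t<K : t < K
  t<K = begin
    suc t    ≤⟨ +-monoˡ-≤ t (s≤s (z≤n {u})) ⟩
    t + t    ≡⟨ cong (t +_) (+-identityʳ t) ⟨
    2 * t    ≤⟨ *-monoˡ-≤ t (≤-trans (s≤s (s≤s z≤n)) 64≤M) ⟩
    K        ∎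
    where open ≤-Reasoning

  instance
    K≢0 : NonZero K
    K≢0 = m*n≢0 M t {{m^n≢0 64 t}}

  n : ℕ
  n = cubeSize d

  G : Graph n
  G = hypercube d

  r lam : ℚ
  r = 1/ℕ K
  lam = fromℕ t ℚ.* r

  Kr≡1 : fromℕ K ℚ.* r ≡ 1ℚ
  Kr≡1 = fromℕ-*-1/ℕ K

  0<lam : 0ℚ ℚ.< lam
  0<lam = subst (ℚ._< lam) (fromℕ-0-* r) (fromℕ-*-mono-< r (1/ℕ-pos K) (s≤s z≤n))

  lam<1 : lam ℚ.< 1ℚ
  lam<1 = subst (lam ℚ.<_) Kr≡1 (fromℕ-*-mono-< r (1/ℕ-pos K) t<K)

  distance-sym : ∀ a b → distance a b ≡ distance b a
  distance-sym a b = cong (λ h → M * (t ⊓ h)) (hamming-sym a b)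

  distance-triangle : ∀ a b c → distance a b ≤ distance a c + distance b c
  distance-triangle a b c = ≤-trans
    (*-monoʳ-≤ M (⊓-triangle t {hamming a b} {hamming a c} {hamming b c} (≤-trans (hamming-triangle a c b) (≤-reflexive (cong (hamming a c +_) (hamming-sym c b))))))
    (≤-reflexive (*-distribˡ-+ M (t ⊓ hamming a c) (t ⊓ hamming b c)))

  y : Fin n → Fin n → ℚ
  y i j = fromℕ (distance (vertex d i) (vertex d j)) ℚ.* r

  y-feasible : LPFeasible y
  y-feasible = (λ i j → cong (λ q → fromℕ q ℚ.* r) (distance-sym (vertex d i) (vertex d j)))
             , (λ i j → subst (ℚ._≤ y i j) (fromℕ-0-* r) (fromℕ-*-mono-≤ r 0≤r z≤n))
             , (λ i j → subst (y i j ℚ.≤_) Kr≡1 (fromℕ-*-mono-≤ r 0≤r (distance≤K (vertex d i) (vertex d j))))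
             , (λ i j k _ _ _ → ℚ.≤-trans (fromℕ-*-mono-≤ r 0≤r (distance-triangle (vertex d i) (vertex d j) (vertex d k)))
                 (ℚ.≤-reflexive (fromℕ-+-* (distance (vertex d i) (vertex d k)) (distance (vertex d j) (vertex d k)) r)))
    where
    0≤r : 0ℚ ℚ.≤ r
    0≤r = ℚ.<⇒≤ (1/ℕ-pos K)

  lpWeightᶠ : Fin n → Fin n → ℕ
  lpWeightᶠ i j = lpWeight (vertex d i) (vertex d j)

  cost-y : cost G lam y ≡ fromℕ (upperSum lpWeightᶠ) ℚ.* (r ℚ.* r)
  cost-y = cost-scaled G t≤K Kr≡1 (λ i j → distance (vertex d i) (vertex d j)) (λ i j → distance≤K (vertex d i) (vertex d j))

  2*upperSum-lpWeight≤ : upperSum lpWeightᶠ + upperSum lpWeightᶠ ≤ n * rowBound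
  2*upperSum-lpWeight≤ = begin
    upperSum lpWeightᶠ + upperSum lpWeightᶠ
      ≤⟨ m≤m+n _ (diagonalSum lpWeightᶠ) ⟩
    upperSum lpWeightᶠ + upperSum lpWeightᶠ + diagonalSum lpWeightᶠ
      ≡⟨ squareSum-symmetric lpWeightᶠ (λ i j → cong₂ fractionalDisagreement′ (Graph.sym G i j) (distance-sym (vertex d i) (vertex d j))) ⟨
    squareSum lpWeightᶠ
      ≡⟨ squareSum-index d lpWeightᶠ ⟩
    cubeSum {d} (λ a → cubeSum {d} (λ b → lpWeightᶠ (index a) (index b)))
      ≡⟨ cubeSum-cong (λ a → cubeSum-cong (λ b → cong₂ lpWeight (vertex-index a) (vertex-index b))) ⟩
    cubeSum rowLpWeight
      ≤⟨ cubeSum-mono-≤ rowLpWeight-≤ ⟩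
    cubeSum {d} (λ _ → rowBound)
      ≡⟨ cubeSum-const {d} rowBound ⟩
    n * rowBound ∎
    where
    open ≤-Reasoning
    fractionalDisagreement′ : Bool → ℕ → ℕ
    fractionalDisagreement′ = fractionalDisagreement A t K

  module _ (c : Clustering n) where

    ipWeight : Fin n → Fin n → ℕ
    ipWeight i j = disagreement A t (does (c i ≟ c j)) (adj G i j)

    ipCost-c : ipCost G lam c ≡ fromℕ (upperSum ipWeight) ℚ.* r
    ipCost-c = ipCost-scaled G t≤K Kr≡1 c

    diagonalSum-ipWeight≤ : diagonalSum ipWeight ≤ n * t
    diagonalSum-ipWeight≤ = begin
      diagonalSum ipWeight         ≤⟨ sum-mono-≤ (λ i → subst (λ e → disagreement A t (does (c i ≟ c i)) e ≤ t)
                                                            (sym (Graph.irref G i)) (non-edge≤t (does (c i ≟ c i)))) ⟩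
      sum (λ (_ : Fin n) → t)      ≡⟨ sum-index d (λ _ → t) ⟩
      cubeSum {d} (λ _ → t)        ≡⟨ cubeSum-const {d} t ⟩
      n * t                        ∎
      where
      open ≤-Reasoning
      non-edge≤t : ∀ same → disagreement A t same false ≤ t
      non-edge≤t true  = ≤-refl
      non-edge≤t false = z≤n

    n*L≤2*upperSum-ipWeight : n * L ≤ upperSum ipWeight + upperSum ipWeight + n * t
    n*L≤2*upperSum-ipWeight = begin
      n * L
        ≤⟨ labellingCost-≥ A t label L clusterCost-≥ ⟩
      labellingCost A t label
        ≡⟨ cubeSum-cong (λ a → cubeSum-cong (λ b →
             cong (disagreement A t (does (label a ≟ label b))) (adj-hypercube-index a b))) ⟨
      cubeSum {d} (λ a → cubeSum {d} (λ b → ipWeight (index a) (index b)))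
        ≡⟨ squareSum-index d ipWeight ⟨
      squareSum ipWeight
        ≡⟨ squareSum-symmetric ipWeight (λ i j → cong₂ (disagreement A t) (does-≟-sym (c i) (c j)) (Graph.sym G i j)) ⟩
      upperSum ipWeight + upperSum ipWeight + diagonalSum ipWeight
        ≤⟨ +-monoʳ-≤ (upperSum ipWeight + upperSum ipWeight) diagonalSum-ipWeight≤ ⟩
      upperSum ipWeight + upperSum ipWeight + n * t ∎
      where
      open ≤-Reasoning
      label : Cube d → Fin n
      label a = c (index a)

  dX+1000Kt≤1000KL : d * rowBound + 1000 * K * t ≤ 1000 * K * L
  dX+1000Kt≤1000KL = begin
    d * rowBound + 1000 * K * t         ≡⟨ expand M t ⟩
    420 * W + 500 * (2 * Z)             ≤⟨ +-monoʳ-≤ (420 * W) (*-monoʳ-≤ 500 (*-monoˡ-≤ Z 2≤Mt)) ⟩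
    420 * W + 500 * (M * t * Z)         ≡⟨ collect M t ⟩
    920 * W                             ≤⟨ *-monoˡ-≤ W (m≤m+n 920 80) ⟩
    1000 * W                            ≡⟨ regroup M t ⟩
    1000 * K * (t * K)                  ≡⟨ cong (λ k → 1000 * K * (t * k)) A+t≡K ⟨
    1000 * K * L                        ∎
    where
    open ≤-Reasoning
    W = M * M * t * t * t
    Z = M * t * t
    2≤Mt : 2 ≤ M * t
    2≤Mt = ≤-trans (≤-trans (s≤s (s≤s z≤n)) 64≤M) (m≤m*n M t)
    expand : ∀ M t → 20 * t * (M * t * M * (20 * t) + t * M * (t * M)) + 1000 * (M * t) * t
                     ≡ 420 * (M * M * t * t * t) + 500 * (2 * (M * t * t))
    expand = solve-∀
    collect : ∀ M t → 420 * (M * M * t * t * t) + 500 * (M * t * (M * t * t)) ≡ 920 * (M * M * t * t * t)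
    collect = solve-∀
    regroup : ∀ M t → 1000 * (M * M * t * t * t) ≡ 1000 * (M * t) * (t * (M * t))
    regroup = solve-∀

  -- Since cost y = PF / K² and ipCost c = PG / K, this is  d · cost y ≤ 1000 · ipCost c.
  d*PF≤1000*K*PG : ∀ PF PG → PF + PF ≤ n * rowBound → n * L ≤ PG + PG + n * t → d * PF ≤ 1000 * K * PG
  d*PF≤1000*K*PG PF PG lp ip = *-cancelˡ-≤ 2 (+-cancelʳ-≤ (k * (n * t)) (2 * (d * PF)) (2 * (k * PG)) (begin
    2 * (d * PF) + k * (n * t)        ≡⟨ cong (_+ k * (n * t)) (double d PF) ⟩
    d * (PF + PF) + k * (n * t)       ≤⟨ +-monoˡ-≤ (k * (n * t)) (*-monoʳ-≤ d lp) ⟩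
    d * (n * rowBound) + k * (n * t)  ≡⟨ factor d n rowBound k t ⟩
    n * (d * rowBound + k * t)               ≤⟨ *-monoʳ-≤ n dX+1000Kt≤1000KL ⟩
    n * (k * L)                       ≡⟨ *-comm-middle n k L ⟩
    k * (n * L)                       ≤⟨ *-monoʳ-≤ k ip ⟩
    k * (PG + PG + n * t)             ≡⟨ unfold k PG (n * t) ⟩
    2 * (k * PG) + k * (n * t)        ∎))
    where
    open ≤-Reasoning
    k = 1000 * K
    double : ∀ d P → 2 * (d * P) ≡ d * (P + P)
    double = solve-∀
    factor : ∀ d n X k t → d * (n * X) + k * (n * t) ≡ n * (d * X + k * t)
    factor = solve-∀
    *-comm-middle : ∀ n k L → n * (k * L) ≡ k * (n * L)
    *-comm-middle = solve-∀
    unfold : ∀ k P e → k * (P + P + e) ≡ 2 * (k * P) + k * e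
    unfold = solve-∀

  u≤n : u ≤ n
  u≤n = ≤-trans (n≤1+n u) (≤-trans (m≤n*m t 20) (<⇒≤ (d<cubeSize d)))

  2≤d : 2 ≤ d
  2≤d = ≤-trans (s≤s (s≤s z≤n)) (m≤m*n 20 t)

  fromℕ-d≡log₂n : fromℕ d ≡ ℤ.+ ⌊log₂ n ⌋ ℚ./ 1
  fromℕ-d≡log₂n = trans (cong fromℕ (sym (⌊log₂cubeSize⌋≡d d))) (fromℕ-def ⌊log₂ n ⌋)

  integrality-gap : (c : Clustering n) → (1/ℕ 1000 ℚ.* fromℕ d) ℚ.* cost G lam y ℚ.≤ ipCost G lam c
  integrality-gap c = begin
    (C ℚ.* fromℕ d) ℚ.* cost G lam y
      ≡⟨ cong ((C ℚ.* fromℕ d) ℚ.*_) cost-y ⟩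
    (C ℚ.* fromℕ d) ℚ.* (fromℕ PF ℚ.* (r ℚ.* r))
      ≡⟨ solve 4 (λ C a b s → (C :* a) :* (b :* s) := (a :* b) :* (C :* s)) refl C (fromℕ d) (fromℕ PF) (r ℚ.* r) ⟩
    (fromℕ d ℚ.* fromℕ PF) ℚ.* (C ℚ.* (r ℚ.* r))
      ≡⟨ cong (ℚ._* (C ℚ.* (r ℚ.* r))) (fromℕ-* d PF) ⟨
    fromℕ (d * PF) ℚ.* (C ℚ.* (r ℚ.* r))
      ≤⟨ fromℕ-*-mono-≤ (C ℚ.* (r ℚ.* r)) 0≤Cr² (d*PF≤1000*K*PG PF PG 2*upperSum-lpWeight≤ (n*L≤2*upperSum-ipWeight c)) ⟩
    fromℕ (1000 * K * PG) ℚ.* (C ℚ.* (r ℚ.* r))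
      ≡⟨ cong (ℚ._* (C ℚ.* (r ℚ.* r))) (trans (fromℕ-* (1000 * K) PG) (cong (ℚ._* fromℕ PG) (fromℕ-* 1000 K))) ⟩
    (fromℕ 1000 ℚ.* fromℕ K ℚ.* fromℕ PG) ℚ.* (C ℚ.* (r ℚ.* r))
      ≡⟨ solve 5 (λ a k p C r → (a :* k :* p) :* (C :* (r :* r)) := (a :* C) :* (k :* r) :* (p :* r))
               refl (fromℕ 1000) (fromℕ K) (fromℕ PG) C r ⟩
    (fromℕ 1000 ℚ.* C) ℚ.* (fromℕ K ℚ.* r) ℚ.* (fromℕ PG ℚ.* r)
      ≡⟨ cong₂ (λ a b → a ℚ.* b ℚ.* (fromℕ PG ℚ.* r)) (fromℕ-*-1/ℕ 1000) Kr≡1 ⟩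
    1ℚ ℚ.* 1ℚ ℚ.* (fromℕ PG ℚ.* r)
      ≡⟨ ℚ.*-identityˡ (fromℕ PG ℚ.* r) ⟩
    fromℕ PG ℚ.* r
      ≡⟨ ipCost-c c ⟨
    ipCost G lam c ∎
    where
    open ℚ.≤-Reasoning
    open +-*-Solver
    C = 1/ℕ 1000
    PF = upperSum lpWeightᶠ
    PG = upperSum (ipWeight c)
    0≤r : 0ℚ ℚ.≤ r
    0≤r = ℚ.<⇒≤ (1/ℕ-pos K)
    0≤Cr² : 0ℚ ℚ.≤ C ℚ.* (r ℚ.* r)
    0≤Cr² = *-nonNeg (ℚ.<⇒≤ (1/ℕ-pos 1000)) (*-nonNeg 0≤r 0≤r)


open import Defs
open import Data.Nat using (ℕ; _≥_)
open import Data.Nat.Logarithm using (⌊log₂_⌋)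
open import Data.Rational using (ℚ; 0ℚ; 1ℚ; _*_; _≤_; _<_)
open import Data.Product using (Σ; _×_; _,_)
open import Data.Fin using (Fin)
import Data.Rational as Q
open import Data.Integer using (+_)
open import Relation.Binary.PropositionalEquality using (subst)
open NatEmbedding using (1/ℕ; 1/ℕ-pos)
open HypercubeGraph using (hypercube-connected; hypercube-cost-pos)

theorem1 : Σ ℚ λ C → (0ℚ < C) × (∀ m → Σ ℕ λ n → (n ≥ m) ×
             Σ (Graph n) λ G → Connected G ×
             Σ ℚ λ lam → (0ℚ < lam) × (lam < 1ℚ) ×
             Σ (Fin n → Fin n → ℚ) λ y → LPFeasible y ×
               (∀ z → LPFeasible z → 0ℚ < cost G lam z) ×
               (∀ (c : Clustering n) →
                  (C * ((+ ⌊log₂ n ⌋) Q./ 1)) * cost G lam y ≤ ipCost G lam c))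
theorem1 = 1/ℕ 1000 , 1/ℕ-pos 1000 , λ m → let open Construction m in
  n , u≤n , G , hypercube-connected d , lam , 0<lam , lam<1 , y , y-feasible ,
  hypercube-cost-pos d 2≤d 0<lam lam<1 ,
  λ c → subst (λ q → (1/ℕ 1000 * q) * cost G lam y ≤ ipCost G lam c) fromℕ-d≡log₂n (integrality-gap c)
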